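{- For each $t\in\{3,4,5\}$ and every integer $r\geq \binom{t}{2}$, the complete graph $K_t$ is $r$-rainbow-uncommon.
   Context: All graphs are simple. A copy of a graph $H$ in a graph $G$ is a subgraph of $G$ isomorphic to $H$. An $r$-coloring of a set $X$ is a surjective function $c:X\to\{1,\dots,r\}$. Under an edge-coloring of $G$, a subgraph $H$ is rainbow if all edges of $H$ receive pairwise distinct colors. For a graph $H$ with $e$ edges, let $M_{\mathrm{rb}}(H;n,r)$ be the maximum, over all $r$-colorings of $E(K_n)$, of the number of rainbow copies of $H$ in $K_n$; let $m_{\mathrm{rb}}(H;n,r)=M_{\mathrm{rb}}(H;n,r)/(\text{number of copies of } H \text{ in } K_n)$ and $m_{\mathrm{rb}}(H;r)=\lim_{n\to\infty} m_{\mathrm{rb}}(H;n,r)$ (this limit exists). $H$ is called $r$-rainbow-common if $m_{\mathrm{rb}}(H;r)=\binom{r}{e}e!/r^e$ (the probability that a fixed copy of $H$ is rainbow under a uniformly random coloring with $r$ colors), and $r$-rainbow-uncommon otherwise. -}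

module Defs where

open import Data.Nat using (ℕ; zero; suc; _≤_; _^_; _!)
import Data.Nat as ℕ
open import Data.Nat.Combinatorics using (_C_)
open import Data.Integer using (+_)
open import Data.Fin using (Fin; zero; suc; _<_)
open import Data.Fin.Properties using (_≟_)
open import Data.Vec using (Vec; []; _∷_)
import Data.Vec as Vec
open import Data.List using (List; []; _∷_; [_]; _++_; map; filter; length)
open import Data.Product using (Σ; ∃; ∃-syntax; _×_)
open import Data.Rational using (ℚ; _/_; 0ℚ; ∣_∣; _-_)
import Data.Rational as ℚ
import Data.List.Relation.Unary.Unique.DecPropositional as UDec

-- An edge-colouring of K_n (vertex set Fin n) with colours Fin r.
-- The edge {i,j} with i < j receives colour c i j; the values c i j for
-- i ≥ j are irrelevant (never used).
EdgeColoring : ℕ → ℕ → Set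
EdgeColoring n r = Fin n → Fin n → Fin r

Surjective : ∀ {n r} → EdgeColoring n r → Set
Surjective {n} {r} c = (k : Fin r) → ∃[ i ] ∃[ j ] (i < j × c i j ≡' k)
  where
  open import Relation.Binary.PropositionalEquality renaming (_≡_ to _≡'_)

-- All t-subsets of Fin n, each listed once as a strictly increasing vector.
-- These are exactly the copies of K_t in K_n.
subsets : (n t : ℕ) → List (Vec (Fin n) t)
subsets n zero = [ [] ]
subsets zero (suc t) = []
subsets (suc n) (suc t) =
  map (λ v → zero ∷ Vec.map suc v) (subsets n t) ++ map (Vec.map suc) (subsets n (suc t))

-- Colours of the edges of the clique spanned by an increasing vector
-- (edge {x,y} with x before y, hence x < y).
edgeColours : ∀ {n r t} → EdgeColoring n r → Vec (Fin n) t → List (Fin r)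
edgeColours c [] = []
edgeColours c (x ∷ xs) = Data.List.map (c x) (Vec.toList xs) ++ edgeColours c xs

rainbowCount : ∀ {n r} (t : ℕ) → EdgeColoring n r → ℕ
rainbowCount {n} {r} t c =
  length (filter (λ v → UDec.unique? (_≟_ {r}) (edgeColours c v)) (subsets n t))

IsMaxRainbow : (t n r M : ℕ) → Set
IsMaxRainbow t n r M =
  (∃[ c ] (Surjective {n} {r} c × rainbowCount t c ≡' M))
  × ((c : EdgeColoring n r) → Surjective c → rainbowCount t c ≤ M)
  where
  open import Relation.Binary.PropositionalEquality renaming (_≡_ to _≡'_)

-- a / d as a rational (d = 0 gives 0 by convention; only used when d > 0).
ratio : ℕ → ℕ → ℚ
ratio a zero = 0ℚ
ratio a (suc d) = (+ a) / suc d

MrbTendsTo : (t r : ℕ) → ℚ → Set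
MrbTendsTo t r L =
  (ε : ℚ) → 0ℚ ℚ.< ε →
  ∃[ N ] ((n : ℕ) → N ≤ n → (M : ℕ) → IsMaxRainbow t n r M →
          ∣ ratio M (n C t) - L ∣ ℚ.< ε)

randomRainbowProb : (t r : ℕ) → ℚ
randomRainbowProb t r = ratio ((r C e) ℕ.* (e !)) (r ^ e)
  where e = t C 2

RainbowCommon : (t r : ℕ) → Set
RainbowCommon t r = MrbTendsTo t r (randomRainbowProb t r)

RainbowUncommon : (t r : ℕ) → Set
RainbowUncommon t r = RainbowCommon t r → Data.Empty.⊥
  where import Data.Empty

{-# OPTIONS --safe #-}
module Submission where

-- Suppose an r-colouring of some Kₖ has R rainbow Kₜ's with t! R / kᵗ above the random value
-- (r C e) e! / rᵉ, where e = t C 2. Blow it up: replace each vertex by s vertices, colour edges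
-- between parts as in Kₖ and edges inside a part by a colouring that uses every colour. For every
-- s this is a surjective colouring of K_{ks} with at least R sᵗ rainbow Kₜ's, i.e. with rainbow
-- density at least t! R / kᵗ, so the maximal density cannot tend to the random value.
-- Such colourings exist: for t = 3 the blow-up of the sum colouring {a, b} ↦ a + b mod r of K_r
-- by itself; for t = 4 and r ≥ 8 the sum colouring, in which a non-rainbow K₄ is determined by
-- three of its vertices; for t = 5 and r ≥ 31 again the sum colouring, as every non-rainbow K₅
-- contains a non-rainbow K₄; and for the finitely many remaining r a small clique whose edges all
-- get different colours, checked by computation.

open import Defs
open import Data.Nat as ℕ using (ℕ; zero; suc; _+_; _*_; _∸_; _^_; _≤_; _<_; z≤n; s≤s; _!; NonZero; _≤ᵇ_)
import Data.Nat.Properties as ℕₚ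
open import Data.Nat.DivMod using (_mod_; _%_; _/_; m<n⇒m%n≡m; [m+n]%n≡m%n; m%n<n)
open import Data.Nat.Combinatorics using (_C_; nCk+nC[k+1]≡[n+1]C[k+1])
open import Data.Nat.Solver using (module +-*-Solver)
open import Data.Fin as Fin using (Fin; zero; suc; toℕ)
import Data.Fin.Properties as Finₚ
import Data.Integer as ℤ
import Data.Integer.Properties as ℤₚ
open import Data.Rational as ℚ using (ℚ; 0ℚ)
import Data.Rational.Properties as ℚₚ
import Data.Rational.Unnormalised as ℚᵘ
import Data.Rational.Unnormalised.Properties as ℚᵘₚ
open import Data.Bool using (Bool; true; false; _∧_; T)
open import Data.Bool.Properties using (T-∧)
open import Data.Vec as Vec using (Vec; []; _∷_)
import Data.Vec.Properties as Vecₚ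
open import Data.Vec.Relation.Unary.All as VecAll using ([]; _∷_)
import Data.Vec.Relation.Unary.All.Properties as VecAllₚ
open import Data.Vec.Relation.Unary.AllPairs as VecAllPairs using ([]; _∷_)
import Data.Vec.Relation.Unary.AllPairs.Properties as VecAllPairsₚ
open import Data.List as List using (List; []; _∷_; _++_; length; filter)
import Data.List.Properties as Listₚ
open import Data.List.Membership.Propositional using (_∈_; _∉_; _─_)
import Data.List.Membership.Propositional.Properties as ∈ₚ
open import Data.List.Relation.Binary.Subset.Propositional using (_⊆_)
open import Data.List.Relation.Unary.Any as Any using (here; there; index)
open import Data.List.Relation.Unary.All as All using ([]; _∷_)
import Data.List.Relation.Unary.All.Properties as Allₚ
open import Data.List.Relation.Unary.AllPairs using ([]; _∷_)
open import Data.List.Relation.Unary.Unique.Propositional using (Unique)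
import Data.List.Relation.Unary.Unique.Propositional.Properties as Uniqueₚ
import Data.List.Relation.Unary.Unique.DecPropositional as UniqueDec
open import Data.Product using (∃-syntax; _×_; _,_; proj₁; proj₂)
open import Data.Sum using (_⊎_; inj₁; inj₂)
open import Data.Empty using (⊥; ⊥-elim)
open import Relation.Nullary using (¬_; yes; no)
open import Relation.Unary using (Pred; Decidable)
open import Relation.Unary.Properties using (∁?)
open import Relation.Binary.PropositionalEquality
open import Function using (Equivalence; _∘_; _∘′_)

open +-*-Solver

module _ {A : Set} where

  ∈-─⁺ : ∀ {x y : A} {ys} (x∈ys : x ∈ ys) → y ∈ ys → y ≢ x → y ∈ ys ─ x∈ys
  ∈-─⁺ (here refl) (here refl) y≢x = ⊥-elim (y≢x refl)
  ∈-─⁺ (here _)    (there y∈ys) _  = y∈ys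
  ∈-─⁺ (there _)   (here refl) _   = here refl
  ∈-─⁺ (there x∈ys) (there y∈ys) y≢x = there (∈-─⁺ x∈ys y∈ys y≢x)

  Unique-⊆⇒length-≤ : ∀ {xs ys : List A} → Unique xs → xs ⊆ ys → length xs ≤ length ys
  Unique-⊆⇒length-≤ {[]} _ _ = z≤n
  Unique-⊆⇒length-≤ {x ∷ xs} {ys} (x∉xs ∷ xs!) x∷xs⊆ys = begin
    suc (length xs)          ≤⟨ s≤s (Unique-⊆⇒length-≤ xs! xs⊆ys─x) ⟩
    suc (length (ys ─ x∈ys)) ≡⟨ sym (Listₚ.length-removeAt′ ys (index x∈ys)) ⟩
    length ys                ∎
    where
    open ℕₚ.≤-Reasoning
    x∈ys = x∷xs⊆ys (here refl)
    xs⊆ys─x : xs ⊆ ys ─ x∈ys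
    xs⊆ys─x y∈xs = ∈-─⁺ x∈ys (x∷xs⊆ys (there y∈xs)) (λ y≡x → All.lookup x∉xs y∈xs (sym y≡x))

  Unique-map⁺ : ∀ {B : Set} {f : A → B} {xs} →
    (∀ {x y} → x ∈ xs → y ∈ xs → f x ≡ f y → x ≡ y) → Unique xs → Unique (List.map f xs)
  Unique-map⁺ {xs = []} _ [] = []
  Unique-map⁺ {xs = x ∷ xs} inj (x∉xs ∷ xs!) =
    Allₚ.map⁺ (All.tabulate λ y∈xs fx≡fy → All.lookup x∉xs y∈xs (inj (here refl) (there y∈xs) fx≡fy))
    ∷ Unique-map⁺ (λ x∈ y∈ → inj (there x∈) (there y∈)) xs!

  length-filter+length-filter-∁ : ∀ {ℓ} {P : Pred A ℓ} (P? : Decidable P) xs →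
    length (filter P? xs) + length (filter (∁? P?) xs) ≡ length xs
  length-filter+length-filter-∁ P? [] = refl
  length-filter+length-filter-∁ P? (x ∷ xs) with P? x
  ... | yes _ = cong suc (length-filter+length-filter-∁ P? xs)
  ... | no  _ = trans (ℕₚ.+-suc _ _) (cong suc (length-filter+length-filter-∁ P? xs))

  length-cartesianProductWith : ∀ {B C : Set} (f : A → B → C) xs ys →
    length (List.cartesianProductWith f xs ys) ≡ length xs * length ys
  length-cartesianProductWith f [] ys = refl
  length-cartesianProductWith f (x ∷ xs) ys = trans (Listₚ.length-++ (List.map (f x) ys))
    (cong₂ _+_ (Listₚ.length-map (f x) ys) (length-cartesianProductWith f xs ys))

  length-concatMap-≤ : ∀ {B : Set} (f : A → List B) {m} xs → (∀ {x} → x ∈ xs → length (f x) ≤ m) →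
    length (List.concatMap f xs) ≤ length xs * m
  length-concatMap-≤ f [] _ = z≤n
  length-concatMap-≤ f (x ∷ xs) bound = subst (_≤ _) (sym (Listₚ.length-++ (f x)))
    (ℕₚ.+-mono-≤ (bound (here refl)) (length-concatMap-≤ f xs (bound ∘ there)))

injectiveOn⇒length-≤ : ∀ {A B : Set} (f : A → B) {xs ys} → Unique xs →
  (∀ {x} → x ∈ xs → f x ∈ ys) → (∀ {x y} → x ∈ xs → y ∈ xs → f x ≡ f y → x ≡ y) →
  length xs ≤ length ys
injectiveOn⇒length-≤ f {xs} xs! f∈ys inj =
  subst (_≤ _) (Listₚ.length-map f xs) (Unique-⊆⇒length-≤ (Unique-map⁺ {f = f} inj xs!) fxs⊆ys)
  where
  fxs⊆ys : List.map f xs ⊆ _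
  fxs⊆ys fx∈ with ∈ₚ.∈-map⁻ f fx∈
  ... | x , x∈xs , refl = f∈ys x∈xs

Increasing : ∀ {n t} → Vec (Fin n) t → Set
Increasing = VecAllPairs.AllPairs Fin._<_

module _ {n : ℕ} where

  Increasing-map-suc : ∀ {t} {xs : Vec (Fin n) t} → Increasing xs → Increasing (Vec.map Fin.suc xs)
  Increasing-map-suc inc = VecAllPairsₚ.map⁺ (VecAllPairs.map s≤s inc)

  Increasing-map-suc⁻ : ∀ {t} {xs : Vec (Fin n) t} → Increasing (Vec.map Fin.suc xs) → Increasing xs
  Increasing-map-suc⁻ {xs = []} [] = []
  Increasing-map-suc⁻ {xs = _ ∷ _} (x<xs ∷ inc) =
    VecAll.map ℕ.s≤s⁻¹ (VecAllₚ.map⁻ x<xs) ∷ Increasing-map-suc⁻ inc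

  zero<map-suc : ∀ {t} (xs : Vec (Fin n) t) → VecAll.All (Fin.zero {n} Fin.<_) (Vec.map Fin.suc xs)
  zero<map-suc xs = VecAllₚ.map⁺ (VecAll.universal (λ _ → s≤s z≤n) xs)

  >⇒map-suc : ∀ {t} {x : Fin (suc n)} (xs : Vec (Fin (suc n)) t) →
    VecAll.All (x Fin.<_) xs → ∃[ ys ] xs ≡ Vec.map Fin.suc ys
  >⇒map-suc [] [] = [] , refl
  >⇒map-suc (suc y ∷ xs) (_ ∷ x<xs) with >⇒map-suc xs x<xs
  ... | ys , refl = y ∷ ys , refl

  map-suc-injective : ∀ {t} {xs ys : Vec (Fin n) t} → Vec.map Fin.suc xs ≡ Vec.map Fin.suc ys → xs ≡ ys
  map-suc-injective {xs = []} {[]} _ = refl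
  map-suc-injective {xs = _ ∷ _} {_ ∷ _} eq with Vecₚ.∷-injective eq
  ... | x≡y , xs≡ys = cong₂ _∷_ (Finₚ.suc-injective x≡y) (map-suc-injective xs≡ys)

prependZero : ∀ {n t} → Vec (Fin n) t → Vec (Fin (suc n)) (suc t)
prependZero v = zero ∷ Vec.map Fin.suc v

∈-subsets⇒Increasing : ∀ n t {v : Vec (Fin n) t} → v ∈ subsets n t → Increasing v
∈-subsets⇒Increasing n zero (here refl) = []
∈-subsets⇒Increasing (suc n) (suc t) v∈ with ∈ₚ.∈-++⁻ (List.map prependZero (subsets n t)) v∈
... | inj₁ v∈₁ with ∈ₚ.∈-map⁻ prependZero v∈₁
...   | w , w∈ , refl = zero<map-suc w ∷ Increasing-map-suc (∈-subsets⇒Increasing n t w∈)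
∈-subsets⇒Increasing (suc n) (suc t) v∈ | inj₂ v∈₂ with ∈ₚ.∈-map⁻ (Vec.map Fin.suc) v∈₂
...   | w , w∈ , refl = Increasing-map-suc (∈-subsets⇒Increasing n (suc t) w∈)

Increasing⇒∈-subsets : ∀ n t {v : Vec (Fin n) t} → Increasing v → v ∈ subsets n t
Increasing⇒∈-subsets n zero {[]} [] = here refl
Increasing⇒∈-subsets (suc n) (suc t) {zero ∷ xs} (0<xs ∷ inc) with >⇒map-suc xs 0<xs
... | w , refl = ∈ₚ.∈-++⁺ˡ (∈ₚ.∈-map⁺ _ (Increasing⇒∈-subsets n t (Increasing-map-suc⁻ inc)))
Increasing⇒∈-subsets (suc n) (suc t) {suc x ∷ xs} inc@(x<xs ∷ _) with >⇒map-suc xs x<xs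
... | w , refl =
  ∈ₚ.∈-++⁺ʳ _ (∈ₚ.∈-map⁺ _ (Increasing⇒∈-subsets n (suc t) {x ∷ w} (Increasing-map-suc⁻ inc)))

subsets-Unique : ∀ n t → Unique (subsets n t)
subsets-Unique n zero = [] ∷ []
subsets-Unique zero (suc t) = []
subsets-Unique (suc n) (suc t) =
  Uniqueₚ.++⁺ (Uniqueₚ.map⁺ (map-suc-injective ∘ proj₂ ∘ Vecₚ.∷-injective) (subsets-Unique n t))
              (Uniqueₚ.map⁺ map-suc-injective (subsets-Unique n (suc t)))
              disjoint
  where
  disjoint : ∀ {v} → v ∈ List.map prependZero (subsets n t) × v ∈ List.map (Vec.map Fin.suc) (subsets n (suc t)) → ⊥
  disjoint (v∈₁ , v∈₂) with ∈ₚ.∈-map⁻ prependZero v∈₁ | ∈ₚ.∈-map⁻ (Vec.map Fin.suc) v∈₂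
  ... | _ , _ , refl | _ ∷ _ , _ , ()

Increasing⇒Unique : ∀ {n t} {v : Vec (Fin n) t} → Increasing v → Unique (Vec.toList v)
Increasing⇒Unique [] = []
Increasing⇒Unique (x<v ∷ inc) = ≢-all x<v ∷ Increasing⇒Unique inc
  where
  ≢-all : ∀ {n t} {x : Fin n} {v : Vec (Fin n) t} → VecAll.All (x Fin.<_) v → All.All (x ≢_) (Vec.toList v)
  ≢-all [] = []
  ≢-all (x<y ∷ x<v) = Finₚ.<⇒≢ x<y ∷ ≢-all x<v

length-subsets : ∀ n t → length (subsets n t) ≡ n C t
length-subsets n zero = refl
length-subsets zero (suc t) = refl
length-subsets (suc n) (suc t) = begin
  length (List.map _ (subsets n t) ++ List.map _ (subsets n (suc t)))
    ≡⟨ Listₚ.length-++ (List.map _ (subsets n t)) ⟩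
  length (List.map _ (subsets n t)) + length (List.map _ (subsets n (suc t)))
    ≡⟨ cong₂ _+_ (Listₚ.length-map _ (subsets n t)) (Listₚ.length-map _ (subsets n (suc t))) ⟩
  length (subsets n t) + length (subsets n (suc t))
    ≡⟨ cong₂ _+_ (length-subsets n t) (length-subsets n (suc t)) ⟩
  n C t + n C suc t
    ≡⟨ nCk+nC[k+1]≡[n+1]C[k+1] n t ⟩
  suc n C suc t ∎
  where open ≡-Reasoning

module _ {n r : ℕ} (c : EdgeColoring n r) where

  Rainbow : ∀ {t} → Vec (Fin n) t → Set
  Rainbow v = Unique (edgeColours c v)

  rainbow? : ∀ {t} → Decidable (Rainbow {t})
  rainbow? v = UniqueDec.unique? Finₚ._≟_ (edgeColours c v)

  rainbowCopies nonRainbowCopies : ∀ t → List (Vec (Fin n) t)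
  rainbowCopies t = filter rainbow? (subsets n t)
  nonRainbowCopies t = filter (∁? rainbow?) (subsets n t)

  ∈-rainbowCopies⁻ : ∀ {t v} → v ∈ rainbowCopies t → Increasing v × Rainbow v
  ∈-rainbowCopies⁻ {t} v∈ with ∈ₚ.∈-filter⁻ rainbow? {xs = subsets n t} v∈
  ... | v∈subsets , rb = ∈-subsets⇒Increasing n t v∈subsets , rb

  ∈-nonRainbowCopies⁻ : ∀ {t v} → v ∈ nonRainbowCopies t → Increasing v × ¬ Rainbow v
  ∈-nonRainbowCopies⁻ {t} v∈ with ∈ₚ.∈-filter⁻ (∁? rainbow?) {xs = subsets n t} v∈
  ... | v∈subsets , ¬rb = ∈-subsets⇒Increasing n t v∈subsets , ¬rb

  ∈-nonRainbowCopies⁺ : ∀ {t v} → Increasing v → ¬ Rainbow v → v ∈ nonRainbowCopies t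
  ∈-nonRainbowCopies⁺ {t} inc ¬rb = ∈ₚ.∈-filter⁺ (∁? rainbow?) (Increasing⇒∈-subsets n t inc) ¬rb

  rainbowCopies-Unique : ∀ t → Unique (rainbowCopies t)
  rainbowCopies-Unique t = Uniqueₚ.filter⁺ rainbow? (subsets-Unique n t)

  nonRainbowCopies-Unique : ∀ t → Unique (nonRainbowCopies t)
  nonRainbowCopies-Unique t = Uniqueₚ.filter⁺ (∁? rainbow?) (subsets-Unique n t)

  nonRainbowCount : ℕ → ℕ
  nonRainbowCount t = length (nonRainbowCopies t)

  rainbowCount≤nCt : ∀ t → rainbowCount t c ≤ n C t
  rainbowCount≤nCt t = subst (rainbowCount t c ≤_) (length-subsets n t) (Listₚ.length-filter rainbow? (subsets n t))

  rainbowCount-≥ : ∀ {t} {xs : List (Vec (Fin n) t)} → Unique xs →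
    (∀ {v} → v ∈ xs → Increasing v × Rainbow v) → length xs ≤ rainbowCount t c
  rainbowCount-≥ {t} xs! rainbow = Unique-⊆⇒length-≤ xs! λ v∈ →
    ∈ₚ.∈-filter⁺ rainbow? (Increasing⇒∈-subsets n t (proj₁ (rainbow v∈))) (proj₂ (rainbow v∈))

  nonRainbowCount≤⇒rainbowCount≥ : ∀ t {b} → nonRainbowCount t ≤ b → n C t ∸ b ≤ rainbowCount t c
  nonRainbowCount≤⇒rainbowCount≥ t {b} bad≤b = begin
    n C t ∸ b                                            ≤⟨ ℕₚ.∸-monoʳ-≤ (n C t) bad≤b ⟩
    n C t ∸ nonRainbowCount t                            ≡⟨ cong (_∸ nonRainbowCount t) total ⟨
    rainbowCount t c + nonRainbowCount t ∸ nonRainbowCount t ≡⟨ ℕₚ.m+n∸n≡m (rainbowCount t c) (nonRainbowCount t) ⟩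
    rainbowCount t c                                     ∎
    where
    open ℕₚ.≤-Reasoning
    total : rainbowCount t c + nonRainbowCount t ≡ n C t
    total = trans (length-filter+length-filter-∁ rainbow? (subsets n t)) (length-subsets n t)

-- Blow-ups

allVecs : ∀ s t → List (Vec (Fin s) t)
allVecs s zero = [] ∷ []
allVecs s (suc t) = List.cartesianProductWith _∷_ (List.allFin s) (allVecs s t)

length-allVecs : ∀ s t → length (allVecs s t) ≡ s ^ t
length-allVecs s zero = refl
length-allVecs s (suc t) = trans (length-cartesianProductWith _∷_ (List.allFin s) (allVecs s t))
  (cong₂ _*_ (Listₚ.length-tabulate {n = s} (λ i → i)) (length-allVecs s t))

allVecs-Unique : ∀ s t → Unique (allVecs s t)
allVecs-Unique s zero = [] ∷ []
allVecs-Unique s (suc t) =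
  Uniqueₚ.cartesianProductWith⁺ _∷_ Vecₚ.∷-injective (Uniqueₚ.allFin⁺ s) (allVecs-Unique s t)

module _ {k s : ℕ} where

  combine-monoʳ-< : ∀ (a : Fin k) {i j : Fin s} → i Fin.< j → Fin.combine a i Fin.< Fin.combine a j
  combine-monoʳ-< a {i} {j} i<j = subst₂ _<_ (sym (Finₚ.toℕ-combine a i)) (sym (Finₚ.toℕ-combine a j))
    (ℕₚ.+-monoʳ-< (s * toℕ a) i<j)

  zipWith-combine-injective : ∀ {t} {w w′ : Vec (Fin k) t} {is is′ : Vec (Fin s) t} →
    Vec.zipWith Fin.combine w is ≡ Vec.zipWith Fin.combine w′ is′ → w ≡ w′ × is ≡ is′
  zipWith-combine-injective {w = []} {[]} {[]} {[]} _ = refl , refl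
  zipWith-combine-injective {w = a ∷ w} {a′ ∷ w′} {i ∷ is} {i′ ∷ is′} eq
    with Vecₚ.∷-injective eq
  ... | head≡ , tail≡ with Finₚ.combine-injective a i a′ i′ head≡ | zipWith-combine-injective tail≡
  ... | refl , refl | refl , refl = refl , refl

  map-combine-injective : ∀ {t} {a a′ : Fin k} {is is′ : Vec (Fin s) (suc t)} →
    Vec.map (Fin.combine a) is ≡ Vec.map (Fin.combine a′) is′ → a ≡ a′ × is ≡ is′
  map-combine-injective {a = a} {a′} {i ∷ is} {i′ ∷ is′} eq
    with Vecₚ.∷-injective eq
  ... | head≡ , tail≡ with Finₚ.combine-injective a i a′ i′ head≡
  ... | refl , refl = refl , cong (i ∷_) (map-injective tail≡)
    where
    map-injective : ∀ {t} {is is′ : Vec (Fin s) t} →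
      Vec.map (Fin.combine a) is ≡ Vec.map (Fin.combine a) is′ → is ≡ is′
    map-injective {is = []} {[]} _ = refl
    map-injective {is = j ∷ is} {j′ ∷ is′} eq with Vecₚ.∷-injective eq
    ... | head≡ , tail≡ = cong₂ _∷_ (Finₚ.combine-injectiveʳ a j a j′ head≡) (map-injective tail≡)

-- The vertex Fin.combine a i of K_{ks} is the i-th vertex of the a-th part.
module BlowUp {k s r : ℕ} (Φ : EdgeColoring k r) (ψ : EdgeColoring s r) where

  pairColour : Fin k × Fin s → Fin k × Fin s → Fin r
  pairColour (a , i) (b , j) with a Finₚ.≟ b
  ... | yes _ = ψ i j
  ... | no  _ = Φ a b

  blowUp : EdgeColoring (k * s) r
  blowUp u v = pairColour (Fin.remQuot s u) (Fin.remQuot s v)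

  blowUp-combine : ∀ a i b j → blowUp (Fin.combine a i) (Fin.combine b j) ≡ pairColour (a , i) (b , j)
  blowUp-combine a i b j = cong₂ pairColour (Finₚ.remQuot-combine {k} {s} a i) (Finₚ.remQuot-combine {k} {s} b j)

  blowUp-between : ∀ {a b} i j → a Fin.< b → blowUp (Fin.combine a i) (Fin.combine b j) ≡ Φ a b
  blowUp-between {a} {b} i j a<b = trans (blowUp-combine a i b j) (between a<b)
    where
    between : a Fin.< b → pairColour (a , i) (b , j) ≡ Φ a b
    between a<b with a Finₚ.≟ b
    ... | yes refl = ⊥-elim (ℕₚ.<-irrefl refl a<b)
    ... | no  _    = refl

  blowUp-within : ∀ a i j → blowUp (Fin.combine a i) (Fin.combine a j) ≡ ψ i j
  blowUp-within a i j = trans (blowUp-combine a i a j) within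
    where
    within : pairColour (a , i) (a , j) ≡ ψ i j
    within with a Finₚ.≟ a
    ... | yes _  = refl
    ... | no a≢a = ⊥-elim (a≢a refl)

  transversal : ∀ {t} → Vec (Fin k) t → Vec (Fin s) t → Vec (Fin (k * s)) t
  transversal = Vec.zipWith Fin.combine

  inPart : ∀ {t} → Fin k → Vec (Fin s) t → Vec (Fin (k * s)) t
  inPart a = Vec.map (Fin.combine a)

  Increasing-transversal : ∀ {t} {w : Vec (Fin k) t} (is : Vec (Fin s) t) → Increasing w → Increasing (transversal w is)
  Increasing-transversal [] [] = []
  Increasing-transversal (i ∷ is) (a<w ∷ inc) = above i is a<w ∷ Increasing-transversal is inc
    where
    above : ∀ {t a} {w : Vec (Fin k) t} i is →
      VecAll.All (a Fin.<_) w → VecAll.All (Fin.combine a i Fin.<_) (transversal w is)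
    above i [] [] = []
    above i (j ∷ is) (a<b ∷ a<w) = Finₚ.combine-monoˡ-< i j a<b ∷ above i is a<w

  Increasing-inPart : ∀ {t} a {u : Vec (Fin s) t} → Increasing u → Increasing (inPart a u)
  Increasing-inPart a inc = VecAllPairsₚ.map⁺ (VecAllPairs.map (combine-monoʳ-< a) inc)

  edgeColours-transversal : ∀ {t} {w : Vec (Fin k) t} (is : Vec (Fin s) t) → Increasing w →
    edgeColours blowUp (transversal w is) ≡ edgeColours Φ w
  edgeColours-transversal [] [] = refl
  edgeColours-transversal {w = a ∷ w} (i ∷ is) (a<w ∷ inc) =
    cong₂ _++_ (row w is a<w) (edgeColours-transversal is inc)
    where
    row : ∀ {t} (w : Vec (Fin k) t) is → VecAll.All (a Fin.<_) w →
      List.map (blowUp (Fin.combine a i)) (Vec.toList (transversal w is)) ≡ List.map (Φ a) (Vec.toList w)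
    row [] [] [] = refl
    row (b ∷ w) (j ∷ is) (a<b ∷ a<w) = cong₂ _∷_ (blowUp-between i j a<b) (row w is a<w)

  edgeColours-inPart : ∀ {t} a (u : Vec (Fin s) t) → edgeColours blowUp (inPart a u) ≡ edgeColours ψ u
  edgeColours-inPart a [] = refl
  edgeColours-inPart a (i ∷ u) = cong₂ _++_ (row u) (edgeColours-inPart a u)
    where
    row : ∀ {t} (u : Vec (Fin s) t) →
      List.map (blowUp (Fin.combine a i)) (Vec.toList (inPart a u)) ≡ List.map (ψ i) (Vec.toList u)
    row [] = refl
    row (j ∷ u) = cong₂ _∷_ (blowUp-within a i j) (row u)

  module _ (t : ℕ) where

    private
      Φ-copies = rainbowCopies Φ (2 + t)
      ψ-copies = rainbowCopies ψ (2 + t)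
      positions = allVecs s (2 + t)

    transversalCopies withinCopies : List (Vec (Fin (k * s)) (2 + t))
    transversalCopies = List.cartesianProductWith transversal Φ-copies positions
    withinCopies = List.cartesianProductWith inPart (List.allFin k) ψ-copies

    rainbow-transversalCopies : ∀ {v} → v ∈ transversalCopies → Increasing v × Rainbow blowUp v
    rainbow-transversalCopies v∈ with ∈ₚ.∈-cartesianProductWith⁻ transversal Φ-copies positions v∈
    ... | w , is , w∈ , _ , refl with ∈-rainbowCopies⁻ Φ w∈
    ...   | inc , rb = Increasing-transversal is inc , subst Unique (sym (edgeColours-transversal is inc)) rb

    rainbow-withinCopies : ∀ {v} → v ∈ withinCopies → Increasing v × Rainbow blowUp v
    rainbow-withinCopies v∈ with ∈ₚ.∈-cartesianProductWith⁻ inPart (List.allFin k) ψ-copies v∈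
    ... | a , u , _ , u∈ , refl with ∈-rainbowCopies⁻ ψ u∈
    ...   | inc , rb = Increasing-inPart a inc , subst Unique (sym (edgeColours-inPart a u)) rb

    -- The first two vertices of a transversal copy lie in distinct parts.
    transversal∉withinCopies : ∀ {v} → v ∈ transversalCopies → v ∈ withinCopies → ⊥
    transversal∉withinCopies v∈₁ v∈₂
      with ∈ₚ.∈-cartesianProductWith⁻ transversal Φ-copies positions v∈₁
         | ∈ₚ.∈-cartesianProductWith⁻ inPart (List.allFin k) ψ-copies v∈₂
    ... | a₀ ∷ a₁ ∷ _ , i₀ ∷ i₁ ∷ _ , w∈ , _ , refl | a , j₀ ∷ j₁ ∷ _ , _ , _ , eq
      with ∈-rainbowCopies⁻ Φ w∈ | Vecₚ.∷-injective eq
    ... | ((a₀<a₁ ∷ _) ∷ _) , _ | eq₀ , eq′ with Vecₚ.∷-injective eq′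
    ... | eq₁ , _ with Finₚ.combine-injectiveˡ a₀ i₀ a j₀ eq₀ | Finₚ.combine-injectiveˡ a₁ i₁ a j₁ eq₁
    ... | refl | refl = ℕₚ.<-irrefl refl a₀<a₁

    rainbowCount-blowUp :
      rainbowCount (2 + t) Φ * s ^ (2 + t) + k * rainbowCount (2 + t) ψ ≤ rainbowCount (2 + t) blowUp
    rainbowCount-blowUp = subst (_≤ rainbowCount (2 + t) blowUp) length-copies
      (rainbowCount-≥ blowUp copies-Unique copies-rainbow)
      where
      copies-Unique : Unique (transversalCopies ++ withinCopies)
      copies-Unique = Uniqueₚ.++⁺
        (Uniqueₚ.cartesianProductWith⁺ transversal zipWith-combine-injective
          (rainbowCopies-Unique Φ (2 + t)) (allVecs-Unique s (2 + t)))
        (Uniqueₚ.cartesianProductWith⁺ inPart map-combine-injective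
          (Uniqueₚ.allFin⁺ k) (rainbowCopies-Unique ψ (2 + t)))
        (λ (v∈₁ , v∈₂) → transversal∉withinCopies v∈₁ v∈₂)
      copies-rainbow : ∀ {v} → v ∈ transversalCopies ++ withinCopies → Increasing v × Rainbow blowUp v
      copies-rainbow v∈ with ∈ₚ.∈-++⁻ transversalCopies v∈
      ... | inj₁ v∈₁ = rainbow-transversalCopies v∈₁
      ... | inj₂ v∈₂ = rainbow-withinCopies v∈₂
      length-copies : length (transversalCopies ++ withinCopies) ≡
        rainbowCount (2 + t) Φ * s ^ (2 + t) + k * rainbowCount (2 + t) ψ
      length-copies = trans (Listₚ.length-++ transversalCopies) (cong₂ _+_
        (trans (length-cartesianProductWith transversal Φ-copies positions)
               (cong (rainbowCount (2 + t) Φ *_) (length-allVecs s (2 + t))))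
        (trans (length-cartesianProductWith inPart (List.allFin k) ψ-copies)
               (cong (_* rainbowCount (2 + t) ψ) (Listₚ.length-tabulate {n = k} (λ i → i)))))

-- The sum colouring

sumColouring : ∀ r .{{_ : NonZero r}} → EdgeColoring r r
sumColouring r a b = (toℕ a + toℕ b) mod r

module SumColouring (r : ℕ) .{{_ : NonZero r}} where

  σ : EdgeColoring r r
  σ = sumColouring r

  -- For p, q < 2r this is p ≡ q (mod r).
  Congruent : ℕ → ℕ → Set
  Congruent p q = p ≡ q ⊎ p ≡ q + r ⊎ q ≡ p + r

  below-2r : ∀ {x} → x < r + r → x ≡ x % r ⊎ x ≡ x % r + r
  below-2r {x} x<2r with x ℕ.<? r
  ... | yes x<r = inj₁ (sym (m<n⇒m%n≡m x<r))
  ... | no  x≮r = inj₂ (begin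
    x                  ≡⟨ ℕₚ.m∸n+n≡m r≤x ⟨
    x ∸ r + r          ≡⟨ cong (_+ r) (m<n⇒m%n≡m x∸r<r) ⟨
    (x ∸ r) % r + r    ≡⟨ cong (_+ r) ([m+n]%n≡m%n (x ∸ r) r) ⟨
    (x ∸ r + r) % r + r ≡⟨ cong (λ y → y % r + r) (ℕₚ.m∸n+n≡m r≤x) ⟩
    x % r + r          ∎)
    where
    open ≡-Reasoning
    r≤x = ℕₚ.≮⇒≥ x≮r
    x∸r<r : x ∸ r < r
    x∸r<r = subst (x ∸ r <_) (ℕₚ.m+n∸n≡m r r) (ℕₚ.∸-monoˡ-< x<2r r≤x)

  %-≡⇒Congruent : ∀ {p q} → p < r + r → q < r + r → p % r ≡ q % r → Congruent p q
  %-≡⇒Congruent {p} {q} p<2r q<2r p≡q with below-2r p<2r | below-2r q<2r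
  ... | inj₁ p≡ | inj₁ q≡ = inj₁ (trans p≡ (trans p≡q (sym q≡)))
  ... | inj₂ p≡ | inj₂ q≡ = inj₁ (trans p≡ (trans (cong (_+ r) p≡q) (sym q≡)))
  ... | inj₂ p≡ | inj₁ q≡ = inj₂ (inj₁ (trans p≡ (cong (_+ r) (trans p≡q (sym q≡)))))
  ... | inj₁ p≡ | inj₂ q≡ = inj₂ (inj₂ (trans q≡ (cong (_+ r) (trans (sym p≡q) (sym p≡)))))

  sum<2r : ∀ (a b : Fin r) → toℕ a + toℕ b < r + r
  sum<2r a b = ℕₚ.+-mono-< (Finₚ.toℕ<n a) (Finₚ.toℕ<n b)

  toℕ-σ : ∀ a b → toℕ (σ a b) ≡ (toℕ a + toℕ b) % r
  toℕ-σ a b = Finₚ.toℕ-fromℕ< (m%n<n (toℕ a + toℕ b) r)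

  σ-comm : ∀ a b → σ a b ≡ σ b a
  σ-comm a b = cong (λ x → x mod r) (ℕₚ.+-comm (toℕ a) (toℕ b))

  σ-≢ : ∀ {a b c d} → let p = toℕ a + toℕ b ; q = toℕ c + toℕ d in
    p ≢ q → p ≢ q + r → q ≢ p + r → σ a b ≢ σ c d
  σ-≢ {a} {b} {c} {d} p≢q p≢q+r q≢p+r σ≡ with %-≡⇒Congruent (sum<2r a b) (sum<2r c d)
                                              (trans (sym (toℕ-σ a b)) (trans (cong toℕ σ≡) (toℕ-σ c d)))
  ... | inj₁ eq = p≢q eq
  ... | inj₂ (inj₁ eq) = p≢q+r eq
  ... | inj₂ (inj₂ eq) = q≢p+r eq

  σ-≢-near : ∀ {a b c d} → let p = toℕ a + toℕ b ; q = toℕ c + toℕ d in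
    p < q → q < p + r → σ a b ≢ σ c d
  σ-≢-near {a} {b} {c} {d} p<q q<p+r =
    σ-≢ {a} {b} {c} {d} (ℕₚ.<⇒≢ p<q) (ℕₚ.<⇒≢ (ℕₚ.<-≤-trans p<q (ℕₚ.m≤m+n _ r))) (ℕₚ.<⇒≢ q<p+r)

  σ-adjacent : ∀ x {y z : Fin r} → y Fin.< z → σ x y ≢ σ x z
  σ-adjacent x {y} {z} y<z = σ-≢-near {x} {y} {x} {z} (ℕₚ.+-monoʳ-< (toℕ x) y<z)
    (subst (toℕ x + toℕ z <_) (sym (ℕₚ.+-assoc (toℕ x) (toℕ y) r))
      (ℕₚ.+-monoʳ-< (toℕ x) (ℕₚ.<-≤-trans (Finₚ.toℕ<n z) (ℕₚ.m≤n+m r (toℕ y)))))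

  σ-adjacentʳˡ : ∀ x {y z : Fin r} → y Fin.< z → σ y x ≢ σ x z
  σ-adjacentʳˡ x y<z eq = σ-adjacent x y<z (trans (σ-comm x _) eq)

  σ-adjacentʳʳ : ∀ x {y z : Fin r} → y Fin.< z → σ y x ≢ σ z x
  σ-adjacentʳʳ x y<z eq = σ-adjacent x y<z (trans (σ-comm x _) (trans eq (σ-comm _ x)))

  triangle-Rainbow : ∀ {v : Vec (Fin r) 3} → Increasing v → Rainbow σ v
  triangle-Rainbow {a ∷ b ∷ c ∷ []} ((a<b ∷ a<c ∷ []) ∷ (b<c ∷ []) ∷ _) =
    (σ-adjacent a b<c ∷ σ-adjacentʳˡ b a<c ∷ []) ∷ (σ-adjacentʳʳ c a<b ∷ []) ∷ [] ∷ []

  rainbowCount-triangles : r C 3 ≤ rainbowCount 3 σ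
  rainbowCount-triangles = subst (_≤ rainbowCount 3 σ) (length-subsets r 3)
    (rainbowCount-≥ σ (subsets-Unique r 3) λ v∈ →
      let inc = ∈-subsets⇒Increasing r 3 v∈ in inc , triangle-Rainbow inc)

  CollisionAD-BC CollisionAB-CD : Vec (Fin r) 4 → Set
  CollisionAD-BC (a ∷ b ∷ c ∷ d ∷ []) = toℕ a + toℕ d ≡ toℕ b + toℕ c
  CollisionAB-CD (a ∷ b ∷ c ∷ d ∷ []) = toℕ c + toℕ d ≡ toℕ a + toℕ b + r

  module _ {a b c d : Fin r} where

    private
      α = toℕ a
      β = toℕ b
      γ = toℕ c
      δ = toℕ d

    -- Adjacent edges always get distinct colours, and the disjoint edges ac and bd too.
    quadruple-Rainbow : Increasing (a ∷ b ∷ c ∷ d ∷ []) →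
      ¬ CollisionAB-CD (a ∷ b ∷ c ∷ d ∷ []) → ¬ CollisionAD-BC (a ∷ b ∷ c ∷ d ∷ []) →
      Rainbow σ (a ∷ b ∷ c ∷ d ∷ [])
    quadruple-Rainbow ((a<b ∷ a<c ∷ a<d ∷ []) ∷ (b<c ∷ b<d ∷ []) ∷ (c<d ∷ []) ∷ [] ∷ []) ¬ab-cd ¬ad-bc =
      (σ-adjacent a b<c ∷ σ-adjacent a b<d ∷ σ-adjacentʳˡ b a<c ∷ σ-adjacentʳˡ b a<d ∷ ab≢cd ∷ []) ∷
      (σ-adjacent a c<d ∷ σ-adjacentʳʳ c a<b ∷ ac≢bd ∷ σ-adjacentʳˡ c a<d ∷ []) ∷
      (ad≢bc ∷ σ-adjacentʳʳ d a<b ∷ σ-adjacentʳʳ d a<c ∷ []) ∷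
      (σ-adjacent b c<d ∷ σ-adjacentʳˡ c b<d ∷ []) ∷
      (σ-adjacentʳʳ d b<c ∷ []) ∷ [] ∷ []
      where
      ab<cd : α + β < γ + δ
      ab<cd = ℕₚ.+-mono-< a<c b<d
      ab≢cd : σ a b ≢ σ c d
      ab≢cd = σ-≢ {a} {b} {c} {d} (ℕₚ.<⇒≢ ab<cd) (ℕₚ.<⇒≢ (ℕₚ.<-≤-trans ab<cd (ℕₚ.m≤m+n (γ + δ) r))) ¬ab-cd
      ac≢bd : σ a c ≢ σ b d
      ac≢bd = σ-≢-near {a} {c} {b} {d} (ℕₚ.+-mono-< a<b c<d)
        (ℕₚ.<-≤-trans (ℕₚ.+-mono-< b<c (Finₚ.toℕ<n d)) (subst (γ + r ≤_) (sym (ℕₚ.+-assoc α γ r)) (ℕₚ.m≤n+m (γ + r) α)))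
      ad≢bc : σ a d ≢ σ b c
      ad≢bc = σ-≢ {a} {d} {b} {c} ¬ad-bc
        (ℕₚ.<⇒≢ (ℕₚ.<-≤-trans (ℕₚ.+-mono-< a<b (Finₚ.toℕ<n d)) (ℕₚ.+-monoˡ-≤ r (ℕₚ.m≤m+n β γ))))
        (ℕₚ.<⇒≢ (ℕₚ.<-≤-trans (ℕₚ.+-mono-< (Finₚ.toℕ<n b) c<d)
          (subst (_≤ α + δ + r) (ℕₚ.+-comm δ r) (ℕₚ.+-monoˡ-≤ r (ℕₚ.m≤n+m δ α)))))

  collisionAB-CD : ∀ (v : Vec (Fin r) 4) → Increasing v → ¬ Rainbow σ v → ¬ CollisionAD-BC v → CollisionAB-CD v
  collisionAB-CD (a ∷ b ∷ c ∷ d ∷ []) inc ¬rainbow ¬ad-bc with toℕ c + toℕ d ℕ.≟ toℕ a + toℕ b + r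
  ... | yes ab-cd = ab-cd
  ... | no ¬ab-cd = ⊥-elim (¬rainbow (quadruple-Rainbow inc ¬ab-cd ¬ad-bc))

  ¬both-collisions : ∀ (a b c d c′ : Fin r) → CollisionAD-BC (a ∷ b ∷ c ∷ d ∷ []) → CollisionAB-CD (b ∷ c ∷ c′ ∷ d ∷ []) → ⊥
  ¬both-collisions a b c d c′ ad-bc c′d-bc = ℕₚ.<-irrefl refl
    (ℕₚ.<-≤-trans (Finₚ.toℕ<n c′) (subst (r ≤_) (sym c′≡a+r) (ℕₚ.m≤n+m r (toℕ a))))
    where
    c′≡a+r : toℕ c′ ≡ toℕ a + r
    c′≡a+r = ℕₚ.+-cancelʳ-≡ (toℕ d) (toℕ c′) (toℕ a + r) (begin
      toℕ c′ + toℕ d        ≡⟨ c′d-bc ⟩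
      toℕ b + toℕ c + r     ≡⟨ cong (_+ r) ad-bc ⟨
      toℕ a + toℕ d + r     ≡⟨ ℕₚ.+-assoc (toℕ a) (toℕ d) r ⟩
      toℕ a + (toℕ d + r)   ≡⟨ cong (toℕ a +_) (ℕₚ.+-comm (toℕ d) r) ⟩
      toℕ a + (r + toℕ d)   ≡⟨ ℕₚ.+-assoc (toℕ a) r (toℕ d) ⟨
      toℕ a + r + toℕ d     ∎)
      where open ≡-Reasoning

  -- A non-rainbow quadruple is determined by three of its vertices: if
  -- a + d = b + c then a is, and otherwise c + d = a + b + r and c is.
  dropVertex : Vec (Fin r) 4 → Vec (Fin r) 3
  dropVertex (a ∷ b ∷ c ∷ d ∷ []) with toℕ a + toℕ d ℕ.≟ toℕ b + toℕ c
  ... | yes _ = b ∷ c ∷ d ∷ []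
  ... | no  _ = a ∷ b ∷ d ∷ []

  Increasing-dropVertex : ∀ (v : Vec (Fin r) 4) → Increasing v → Increasing (dropVertex v)
  Increasing-dropVertex (a ∷ b ∷ c ∷ d ∷ []) ((a<b ∷ a<c ∷ a<d ∷ []) ∷ (b<c ∷ b<d ∷ []) ∷ (c<d ∷ []) ∷ [] ∷ [])
    with toℕ a + toℕ d ℕ.≟ toℕ b + toℕ c
  ... | yes _ = (b<c ∷ b<d ∷ []) ∷ (c<d ∷ []) ∷ [] ∷ []
  ... | no  _ = (a<b ∷ a<d ∷ []) ∷ (b<d ∷ []) ∷ [] ∷ []

  dropVertex-injective : ∀ (v w : Vec (Fin r) 4) → Increasing v → Increasing w → ¬ Rainbow σ v → ¬ Rainbow σ w →
    dropVertex v ≡ dropVertex w → v ≡ w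
  dropVertex-injective (a ∷ b ∷ c ∷ d ∷ []) (a′ ∷ b′ ∷ c′ ∷ d′ ∷ []) incv incw ¬rbv ¬rbw eq
    with toℕ a + toℕ d ℕ.≟ toℕ b + toℕ c | toℕ a′ + toℕ d′ ℕ.≟ toℕ b′ + toℕ c′
  ... | yes ad-bc | yes ad-bc′ with refl ← eq
    = cong (_∷ _) (Finₚ.toℕ-injective (ℕₚ.+-cancelʳ-≡ (toℕ d) (toℕ a) (toℕ a′) (trans ad-bc (sym ad-bc′))))
  ... | no ¬ad-bc | no ¬ad-bc′ with refl ← eq
    = cong (λ x → a ∷ b ∷ x ∷ d ∷ []) (Finₚ.toℕ-injective (ℕₚ.+-cancelʳ-≡ (toℕ d) (toℕ c) (toℕ c′)
        (trans (collisionAB-CD _ incv ¬rbv ¬ad-bc) (sym (collisionAB-CD _ incw ¬rbw ¬ad-bc′)))))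
  ... | yes ad-bc | no ¬ad-bc′ with refl ← eq
    = ⊥-elim (¬both-collisions a b c d c′ ad-bc (collisionAB-CD _ incw ¬rbw ¬ad-bc′))
  ... | no ¬ad-bc | yes ad-bc′ with refl ← eq
    = ⊥-elim (¬both-collisions a′ b′ c′ d′ c ad-bc′ (collisionAB-CD _ incv ¬rbv ¬ad-bc))

  nonRainbowCount-quadruples : nonRainbowCount σ 4 ≤ r C 3
  nonRainbowCount-quadruples = subst (nonRainbowCount σ 4 ≤_) (length-subsets r 3)
    (injectiveOn⇒length-≤ dropVertex (nonRainbowCopies-Unique σ 4)
      (λ v∈ → Increasing⇒∈-subsets r 3 (Increasing-dropVertex _ (proj₁ (∈-nonRainbowCopies⁻ σ v∈))))
      (λ v∈ w∈ → dropVertex-injective _ _ (proj₁ (∈-nonRainbowCopies⁻ σ v∈)) (proj₁ (∈-nonRainbowCopies⁻ σ w∈))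
                                          (proj₂ (∈-nonRainbowCopies⁻ σ v∈)) (proj₂ (∈-nonRainbowCopies⁻ σ w∈))))

module _ {k : ℕ} where

  open import Data.List.Membership.DecPropositional (Finₚ._≟_ {k}) using (_∉?_)

  outside : List (Fin k) → List (Fin k)
  outside xs = filter (_∉? xs) (List.allFin k)

  ∉⇒∈-outside : ∀ {x xs} → x ∉ xs → x ∈ outside xs
  ∉⇒∈-outside {x} {xs} = ∈ₚ.∈-filter⁺ (_∉? xs) (∈ₚ.∈-allFin x)

  length-outside : ∀ {xs} → Unique xs → length (outside xs) ≤ k ∸ length xs
  length-outside {xs} xs! = begin
    length (outside xs)           ≡⟨ ℕₚ.m+n∸n≡m _ (length inside) ⟨
    length (outside xs) + length inside ∸ length inside
      ≡⟨ cong (_∸ length inside) (trans (length-filter+length-filter-∁ (_∉? xs) (List.allFin k))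
                                        (Listₚ.length-tabulate {n = k} (λ i → i))) ⟩
    k ∸ length inside              ≤⟨ ℕₚ.∸-monoʳ-≤ k (Unique-⊆⇒length-≤ xs! xs⊆inside) ⟩
    k ∸ length xs                  ∎
    where
    open ℕₚ.≤-Reasoning
    inside = filter (∁? (_∉? xs)) (List.allFin k)
    xs⊆inside : ∀ {x} → x ∈ xs → x ∈ inside
    xs⊆inside {x} x∈xs = ∈ₚ.∈-filter⁺ (∁? (_∉? xs)) (∈ₚ.∈-allFin x) (λ x∉xs → x∉xs x∈xs)

  insert : ∀ {t} → Fin k → Vec (Fin k) t → Vec (Fin k) (suc t)
  insert x [] = x ∷ []
  insert x (y ∷ ys) with x Fin.<? y
  ... | yes _ = x ∷ y ∷ ys
  ... | no  _ = y ∷ insert x ys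

  insert-< : ∀ {t x y} {ys : Vec (Fin k) t} → x Fin.< y → insert x (y ∷ ys) ≡ x ∷ y ∷ ys
  insert-< {x = x} {y} x<y with x Fin.<? y
  ... | yes _   = refl
  ... | no  x≮y = ⊥-elim (x≮y x<y)

  insert-> : ∀ {t x y} {ys : Vec (Fin k) t} → y Fin.< x → insert x (y ∷ ys) ≡ y ∷ insert x ys
  insert-> {x = x} {y} y<x with x Fin.<? y
  ... | yes x<y = ⊥-elim (ℕₚ.<-asym x<y y<x)
  ... | no  _   = refl

  >⇒≢ : ∀ {x y : Fin k} → y Fin.< x → x ≢ y
  >⇒≢ = ≢-sym ∘ Finₚ.<⇒≢

module _ {k r : ℕ} (χ : EdgeColoring k r) where

  -- Any two edges of K₅ span at most four vertices, so they lie in one of its K₄'s.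
  rainbow-K₅ : ∀ a b c d e →
    Rainbow χ (b ∷ c ∷ d ∷ e ∷ []) → Rainbow χ (a ∷ c ∷ d ∷ e ∷ []) → Rainbow χ (a ∷ b ∷ d ∷ e ∷ []) →
    Rainbow χ (a ∷ b ∷ c ∷ e ∷ []) → Rainbow χ (a ∷ b ∷ c ∷ d ∷ []) → Rainbow χ (a ∷ b ∷ c ∷ d ∷ e ∷ [])
  rainbow-K₅ a b c d e
    ((bc≢bd ∷ bc≢be ∷ bc≢cd ∷ bc≢ce ∷ bc≢de ∷ []) ∷ (bd≢be ∷ bd≢cd ∷ bd≢ce ∷ bd≢de ∷ []) ∷
     (be≢cd ∷ be≢ce ∷ be≢de ∷ []) ∷ (cd≢ce ∷ cd≢de ∷ []) ∷ (ce≢de ∷ []) ∷ [] ∷ [])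
    ((ac≢ad ∷ ac≢ae ∷ ac≢cd ∷ ac≢ce ∷ ac≢de ∷ []) ∷ (ad≢ae ∷ ad≢cd ∷ ad≢ce ∷ ad≢de ∷ []) ∷
     (ae≢cd ∷ ae≢ce ∷ ae≢de ∷ []) ∷ (_ ∷ _ ∷ []) ∷ (_ ∷ []) ∷ [] ∷ [])
    ((ab≢ad ∷ ab≢ae ∷ ab≢bd ∷ ab≢be ∷ ab≢de ∷ []) ∷ (_ ∷ ad≢bd ∷ ad≢be ∷ _ ∷ []) ∷
     (ae≢bd ∷ ae≢be ∷ _ ∷ []) ∷ (_ ∷ _ ∷ []) ∷ (_ ∷ []) ∷ [] ∷ [])
    ((ab≢ac ∷ _ ∷ ab≢bc ∷ _ ∷ ab≢ce ∷ []) ∷ (_ ∷ ac≢bc ∷ ac≢be ∷ _ ∷ []) ∷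
     (ae≢bc ∷ _ ∷ _ ∷ []) ∷ (_ ∷ _ ∷ []) ∷ (_ ∷ []) ∷ [] ∷ [])
    ((_ ∷ _ ∷ _ ∷ _ ∷ ab≢cd ∷ []) ∷ (_ ∷ _ ∷ ac≢bd ∷ _ ∷ []) ∷ (ad≢bc ∷ _ ∷ _ ∷ []) ∷ (_ ∷ _ ∷ []) ∷ (_ ∷ []) ∷ [] ∷ [])
    = (ab≢ac ∷ ab≢ad ∷ ab≢ae ∷ ab≢bc ∷ ab≢bd ∷ ab≢be ∷ ab≢cd ∷ ab≢ce ∷ ab≢de ∷ []) ∷
      (ac≢ad ∷ ac≢ae ∷ ac≢bc ∷ ac≢bd ∷ ac≢be ∷ ac≢cd ∷ ac≢ce ∷ ac≢de ∷ []) ∷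
      (ad≢ae ∷ ad≢bc ∷ ad≢bd ∷ ad≢be ∷ ad≢cd ∷ ad≢ce ∷ ad≢de ∷ []) ∷
      (ae≢bc ∷ ae≢bd ∷ ae≢be ∷ ae≢cd ∷ ae≢ce ∷ ae≢de ∷ []) ∷
      (bc≢bd ∷ bc≢be ∷ bc≢cd ∷ bc≢ce ∷ bc≢de ∷ []) ∷
      (bd≢be ∷ bd≢cd ∷ bd≢ce ∷ bd≢de ∷ []) ∷
      (be≢cd ∷ be≢ce ∷ be≢de ∷ []) ∷
      (cd≢ce ∷ cd≢de ∷ []) ∷
      (ce≢de ∷ []) ∷ [] ∷ []

  IsSplit : Vec (Fin k) 5 → Vec (Fin k) 4 × Fin k → Set
  IsSplit S (B , x) = Increasing B × ¬ Rainbow χ B × x ∉ Vec.toList B × insert x B ≡ S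

  splitOffNonRainbow : Vec (Fin k) 5 → Vec (Fin k) 4 × Fin k
  splitOffNonRainbow (a ∷ b ∷ c ∷ d ∷ e ∷ []) with rainbow? χ (b ∷ c ∷ d ∷ e ∷ [])
  ... | no _ = (b ∷ c ∷ d ∷ e ∷ []) , a
  ... | yes _ with rainbow? χ (a ∷ c ∷ d ∷ e ∷ [])
  ...   | no _ = (a ∷ c ∷ d ∷ e ∷ []) , b
  ...   | yes _ with rainbow? χ (a ∷ b ∷ d ∷ e ∷ [])
  ...     | no _ = (a ∷ b ∷ d ∷ e ∷ []) , c
  ...     | yes _ with rainbow? χ (a ∷ b ∷ c ∷ e ∷ [])
  ...       | no _ = (a ∷ b ∷ c ∷ e ∷ []) , d
  ...       | yes _ = (a ∷ b ∷ c ∷ d ∷ []) , e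

  splitOffNonRainbow-IsSplit : ∀ S → Increasing S → ¬ Rainbow χ S → IsSplit S (splitOffNonRainbow S)
  splitOffNonRainbow-IsSplit (a ∷ b ∷ c ∷ d ∷ e ∷ [])
    ((a<b ∷ a<c ∷ a<d ∷ a<e ∷ []) ∷ (b<c ∷ b<d ∷ b<e ∷ []) ∷ (c<d ∷ c<e ∷ []) ∷ (d<e ∷ []) ∷ [] ∷ []) ¬rainbow
    with rainbow? χ (b ∷ c ∷ d ∷ e ∷ [])
  ... | no ¬rb₀ =
    (b<c ∷ b<d ∷ b<e ∷ []) ∷ (c<d ∷ c<e ∷ []) ∷ (d<e ∷ []) ∷ [] ∷ [] , ¬rb₀ ,
    Allₚ.All¬⇒¬Any (Finₚ.<⇒≢ a<b ∷ Finₚ.<⇒≢ a<c ∷ Finₚ.<⇒≢ a<d ∷ Finₚ.<⇒≢ a<e ∷ []) , insert-< a<b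
  ... | yes rb₀ with rainbow? χ (a ∷ c ∷ d ∷ e ∷ [])
  ...   | no ¬rb₁ =
    (a<c ∷ a<d ∷ a<e ∷ []) ∷ (c<d ∷ c<e ∷ []) ∷ (d<e ∷ []) ∷ [] ∷ [] , ¬rb₁ ,
    Allₚ.All¬⇒¬Any (>⇒≢ a<b ∷ Finₚ.<⇒≢ b<c ∷ Finₚ.<⇒≢ b<d ∷ Finₚ.<⇒≢ b<e ∷ []) ,
    trans (insert-> a<b) (cong (a ∷_) (insert-< b<c))
  ...   | yes rb₁ with rainbow? χ (a ∷ b ∷ d ∷ e ∷ [])
  ...     | no ¬rb₂ =
    (a<b ∷ a<d ∷ a<e ∷ []) ∷ (b<d ∷ b<e ∷ []) ∷ (d<e ∷ []) ∷ [] ∷ [] , ¬rb₂ ,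
    Allₚ.All¬⇒¬Any (>⇒≢ a<c ∷ >⇒≢ b<c ∷ Finₚ.<⇒≢ c<d ∷ Finₚ.<⇒≢ c<e ∷ []) ,
    trans (insert-> a<c) (cong (a ∷_) (trans (insert-> b<c) (cong (b ∷_) (insert-< c<d))))
  ...     | yes rb₂ with rainbow? χ (a ∷ b ∷ c ∷ e ∷ [])
  ...       | no ¬rb₃ =
    (a<b ∷ a<c ∷ a<e ∷ []) ∷ (b<c ∷ b<e ∷ []) ∷ (c<e ∷ []) ∷ [] ∷ [] , ¬rb₃ ,
    Allₚ.All¬⇒¬Any (>⇒≢ a<d ∷ >⇒≢ b<d ∷ >⇒≢ c<d ∷ Finₚ.<⇒≢ d<e ∷ []) ,
    trans (insert-> a<d) (cong (a ∷_) (trans (insert-> b<d) (cong (b ∷_) (trans (insert-> c<d) (cong (c ∷_) (insert-< d<e))))))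
  ...       | yes rb₃ with rainbow? χ (a ∷ b ∷ c ∷ d ∷ [])
  ...         | no ¬rb₄ =
    (a<b ∷ a<c ∷ a<d ∷ []) ∷ (b<c ∷ b<d ∷ []) ∷ (c<d ∷ []) ∷ [] ∷ [] , ¬rb₄ ,
    Allₚ.All¬⇒¬Any (>⇒≢ a<e ∷ >⇒≢ b<e ∷ >⇒≢ c<e ∷ >⇒≢ d<e ∷ []) ,
    trans (insert-> a<e) (cong (a ∷_) (trans (insert-> b<e) (cong (b ∷_) (trans (insert-> c<e) (cong (c ∷_) (insert-> d<e))))))
  ...         | yes rb₄ = ⊥-elim (¬rainbow (rainbow-K₅ a b c d e rb₀ rb₁ rb₂ rb₃ rb₄))

  nonRainbowCount-K₅ : nonRainbowCount χ 5 ≤ nonRainbowCount χ 4 * (k ∸ 4)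
  nonRainbowCount-K₅ = ℕₚ.≤-trans
    (injectiveOn⇒length-≤ splitOffNonRainbow (nonRainbowCopies-Unique χ 5) split∈splits split-injective)
    (length-concatMap-≤ extensions (nonRainbowCopies χ 4) length-extensions)
    where
    extensions : Vec (Fin k) 4 → List (Vec (Fin k) 4 × Fin k)
    extensions B = List.map (B ,_) (outside (Vec.toList B))
    length-extensions : ∀ {B} → B ∈ nonRainbowCopies χ 4 → length (extensions B) ≤ k ∸ 4
    length-extensions {B} B∈ = begin
      length (extensions B)             ≡⟨ Listₚ.length-map (B ,_) (outside (Vec.toList B)) ⟩
      length (outside (Vec.toList B))   ≤⟨ length-outside (Increasing⇒Unique (proj₁ (∈-nonRainbowCopies⁻ χ B∈))) ⟩
      k ∸ length (Vec.toList B)         ≡⟨ cong (k ∸_) (Vecₚ.length-toList B) ⟩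
      k ∸ 4                             ∎
      where open ℕₚ.≤-Reasoning
    isSplit : ∀ {S} → S ∈ nonRainbowCopies χ 5 → IsSplit S (splitOffNonRainbow S)
    isSplit S∈ with ∈-nonRainbowCopies⁻ χ S∈
    ... | inc , ¬rb = splitOffNonRainbow-IsSplit _ inc ¬rb
    split-injective : ∀ {S S′} → S ∈ nonRainbowCopies χ 5 → S′ ∈ nonRainbowCopies χ 5 →
      splitOffNonRainbow S ≡ splitOffNonRainbow S′ → S ≡ S′
    split-injective S∈ S′∈ eq with isSplit S∈ | isSplit S′∈
    ... | _ , _ , _ , insert≡S | _ , _ , _ , insert≡S′ =
      trans (sym insert≡S) (trans (cong (λ (B , x) → insert x B) eq) insert≡S′)
    split∈splits : ∀ {S} → S ∈ nonRainbowCopies χ 5 → splitOffNonRainbow S ∈ List.concatMap extensions (nonRainbowCopies χ 4)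
    split∈splits {S} S∈ with isSplit S∈
    ... | inc , ¬rb , x∉B , _ = ∈ₚ.∈-concatMap⁺ extensions (Any.map (λ { refl → extension∈ }) (∈-nonRainbowCopies⁺ χ inc ¬rb))
      where
      extension∈ : splitOffNonRainbow S ∈ extensions (proj₁ (splitOffNonRainbow S))
      extension∈ = ∈ₚ.∈-map⁺ _ (∉⇒∈-outside x∉B)

fallingFactorial : ℕ → ℕ → ℕ
fallingFactorial n zero = 1
fallingFactorial zero (suc k) = 0
fallingFactorial (suc n) (suc k) = suc n * fallingFactorial n k

fallingFactorial-suc : ∀ n k → fallingFactorial n (suc k) + k * fallingFactorial n k ≡ n * fallingFactorial n k
fallingFactorial-suc zero zero = refl
fallingFactorial-suc (suc n) zero = ℕₚ.+-identityʳ _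
fallingFactorial-suc zero (suc k) = ℕₚ.*-zeroʳ (suc k)
fallingFactorial-suc (suc n) (suc k) = begin
  suc n * fallingFactorial n (suc k) + suc k * (suc n * fallingFactorial n k)
    ≡⟨ solve 4 (λ n a b k → n :* a :+ (con 1 :+ k) :* (n :* b) := n :* (a :+ k :* b :+ b))
               refl (suc n) (fallingFactorial n (suc k)) (fallingFactorial n k) k ⟩
  suc n * (fallingFactorial n (suc k) + k * fallingFactorial n k + fallingFactorial n k)
    ≡⟨ cong (λ x → suc n * (x + fallingFactorial n k)) (fallingFactorial-suc n k) ⟩
  suc n * (n * fallingFactorial n k + fallingFactorial n k)
    ≡⟨ cong (suc n *_) (ℕₚ.+-comm (n * fallingFactorial n k) (fallingFactorial n k)) ⟩
  suc n * (suc n * fallingFactorial n k) ∎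
  where open ≡-Reasoning

fallingFactorial-sucʳ : ∀ n k → fallingFactorial n (suc k) ≡ fallingFactorial n k * (n ∸ k)
fallingFactorial-sucʳ zero zero = refl
fallingFactorial-sucʳ zero (suc k) = refl
fallingFactorial-sucʳ (suc n) zero = trans (ℕₚ.*-identityʳ (suc n)) (sym (ℕₚ.*-identityˡ (suc n)))
fallingFactorial-sucʳ (suc n) (suc k) = trans (cong (suc n *_) (fallingFactorial-sucʳ n k))
  (sym (ℕₚ.*-assoc (suc n) (fallingFactorial n k) (n ∸ k)))

k!*nCk≡fallingFactorial : ∀ n k → k ! * (n C k) ≡ fallingFactorial n k
k!*nCk≡fallingFactorial n zero = refl
k!*nCk≡fallingFactorial zero (suc k) = ℕₚ.*-zeroʳ (suc k !)
k!*nCk≡fallingFactorial (suc n) (suc k) = begin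
  suc k ! * (suc n C suc k)
    ≡⟨ cong (suc k ! *_) (nCk+nC[k+1]≡[n+1]C[k+1] n k) ⟨
  (suc k * k !) * (n C k + n C suc k)
    ≡⟨ solve 4 (λ K f a b → (K :* f) :* (a :+ b) := K :* (f :* a) :+ (K :* f) :* b)
               refl (suc k) (k !) (n C k) (n C suc k) ⟩
  suc k * (k ! * (n C k)) + suc k ! * (n C suc k)
    ≡⟨ cong₂ (λ x y → suc k * x + y) (k!*nCk≡fallingFactorial n k) (k!*nCk≡fallingFactorial n (suc k)) ⟩
  suc k * fallingFactorial n k + fallingFactorial n (suc k)
    ≡⟨ solve 3 (λ k f g → (con 1 :+ k) :* f :+ g := (g :+ k :* f) :+ f) refl k (fallingFactorial n k) (fallingFactorial n (suc k)) ⟩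
  (fallingFactorial n (suc k) + k * fallingFactorial n k) + fallingFactorial n k
    ≡⟨ cong (_+ fallingFactorial n k) (fallingFactorial-suc n k) ⟩
  n * fallingFactorial n k + fallingFactorial n k
    ≡⟨ ℕₚ.+-comm (n * fallingFactorial n k) (fallingFactorial n k) ⟩
  suc n * fallingFactorial n k ∎
  where open ≡-Reasoning

nCk*k!≡fallingFactorial : ∀ n k → (n C k) * k ! ≡ fallingFactorial n k
nCk*k!≡fallingFactorial n k = trans (ℕₚ.*-comm (n C k) (k !)) (k!*nCk≡fallingFactorial n k)

fallingFactorial≤^ : ∀ n k → fallingFactorial n k ≤ n ^ k
fallingFactorial≤^ n zero = ℕₚ.≤-refl
fallingFactorial≤^ zero (suc k) = z≤n
fallingFactorial≤^ (suc n) (suc k) =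
  ℕₚ.*-monoʳ-≤ (suc n) (ℕₚ.≤-trans (fallingFactorial≤^ n k) (ℕₚ.^-monoˡ-≤ k (ℕₚ.n≤1+n n)))

^-distribʳ-* : ∀ m n o → (m * n) ^ o ≡ m ^ o * n ^ o
^-distribʳ-* m n zero = refl
^-distribʳ-* m n (suc o) = trans (cong (m * n *_) (^-distribʳ-* m n o))
  (solve 4 (λ m n x y → (m :* n) :* (x :* y) := (m :* x) :* (n :* y)) refl m n (m ^ o) (n ^ o))

ratio-≤ : ∀ a b c d → 0 < b → 0 < d → a * d ≤ c * b → ratio a b ℚ.≤ ratio c d
ratio-≤ a (suc b) c (suc d) _ _ ad≤cb = ℚₚ.toℚᵘ-cancel-≤
  (ℚᵘₚ.≤-respˡ-≃ (ℚᵘₚ.≃-sym (ℚₚ.toℚᵘ-fromℚᵘ (ℚᵘ.mkℚᵘ (ℤ.+ a) b)))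
  (ℚᵘₚ.≤-respʳ-≃ (ℚᵘₚ.≃-sym (ℚₚ.toℚᵘ-fromℚᵘ (ℚᵘ.mkℚᵘ (ℤ.+ c) d)))
  (ℚᵘ.*≤* (subst₂ ℤ._≤_ (ℤₚ.pos-* a (suc d)) (ℤₚ.pos-* c (suc b)) (ℤ.+≤+ ad≤cb)))))

ratio-< : ∀ a b c d → 0 < b → 0 < d → a * d < c * b → ratio a b ℚ.< ratio c d
ratio-< a (suc b) c (suc d) _ _ ad<cb = ℚₚ.toℚᵘ-cancel-<
  (ℚᵘₚ.<-respˡ-≃ (ℚᵘₚ.≃-sym (ℚₚ.toℚᵘ-fromℚᵘ (ℚᵘ.mkℚᵘ (ℤ.+ a) b)))
  (ℚᵘₚ.<-respʳ-≃ (ℚᵘₚ.≃-sym (ℚₚ.toℚᵘ-fromℚᵘ (ℚᵘ.mkℚᵘ (ℤ.+ c) d)))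
  (ℚᵘ.*<* (subst₂ ℤ._<_ (ℤₚ.pos-* a (suc d)) (ℤₚ.pos-* c (suc b)) (ℤ.+<+ ad<cb)))))

0<p-q : ∀ {p q : ℚ} → q ℚ.< p → 0ℚ ℚ.< p ℚ.- q
0<p-q {p} {q} q<p = subst (ℚ._< p ℚ.- q) (ℚₚ.+-inverseʳ q) (ℚₚ.+-monoˡ-< (ℚ.- q) q<p)

far-from : ∀ {x p q : ℚ} → q ℚ.< p → p ℚ.≤ x → ¬ (ℚ.∣ x ℚ.- q ∣ ℚ.< p ℚ.- q)
far-from {x} {p} {q} q<p p≤x ∣x-q∣<p-q = ℚₚ.<-irrefl refl (ℚₚ.≤-<-trans p-q≤x-q (subst (ℚ._< p ℚ.- q) ∣x-q∣≡x-q ∣x-q∣<p-q))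
  where
  p-q≤x-q : p ℚ.- q ℚ.≤ x ℚ.- q
  p-q≤x-q = ℚₚ.+-monoˡ-≤ (ℚ.- q) p≤x
  ∣x-q∣≡x-q : ℚ.∣ x ℚ.- q ∣ ≡ x ℚ.- q
  ∣x-q∣≡x-q = ℚₚ.0≤p⇒∣p∣≡p (ℚₚ.<⇒≤ (ℚₚ.<-≤-trans (0<p-q q<p) p-q≤x-q))

¬¬-maximum : ∀ (P : ℕ → Set) {m} d → P m → ¬ P (d + m) → ¬ ¬ (∃[ M ] (m ≤ M × P M × ¬ P (suc M)))
¬¬-maximum P zero Pm ¬Pm _ = ¬Pm Pm
¬¬-maximum P {m} (suc d) Pm ¬Pd+m ¬max = ¬max (m , ℕₚ.≤-refl , Pm , λ Psm →
  ¬¬-maximum P d Psm (¬Pd+m ∘′ subst P (ℕₚ.+-suc d m))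
    (λ (M , sm≤M , PM , ¬PsM) → ¬max (M , ℕₚ.≤-trans (ℕₚ.n≤1+n m) sm≤M , PM , ¬PsM)))

starColouring : ∀ s r .{{_ : NonZero r}} → EdgeColoring s r
starColouring s r _ j = (toℕ j ∸ 1) mod r

starColouring-surjective : ∀ {s r} .{{_ : NonZero r}} → r < s → Surjective (starColouring s r)
starColouring-surjective {suc s} {r} (s≤s r≤s) m = zero , suc m′ , s≤s z≤n , Finₚ.toℕ-injective (begin
  toℕ (toℕ m′ mod r) ≡⟨ Finₚ.toℕ-fromℕ< (m%n<n (toℕ m′) r) ⟩
  toℕ m′ % r         ≡⟨ cong (_% r) (Finₚ.toℕ-inject≤ m r≤s) ⟩
  toℕ m % r          ≡⟨ m<n⇒m%n≡m (Finₚ.toℕ<n m) ⟩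
  toℕ m              ∎)
  where
  open ≡-Reasoning
  m′ = Fin.inject≤ m r≤s

blowUp-surjective : ∀ {k s r} (Φ : EdgeColoring (suc k) r) {ψ : EdgeColoring s r} →
  Surjective ψ → Surjective (BlowUp.blowUp Φ ψ)
blowUp-surjective {k} Φ {ψ} ψ-surjective m with ψ-surjective m
... | i , j , i<j , ψij≡m =
  Fin.combine (zero {k}) i , Fin.combine (zero {k}) j , combine-monoʳ-< (zero {k}) i<j ,
  trans (BlowUp.blowUp-within Φ ψ zero i j) ψij≡m

-- The maximum over all colourings is only available under ¬¬, which suffices because
-- uncommonness is a negation.
¬¬IsMaxRainbow : ∀ t {n r} (c : EdgeColoring n r) → Surjective c →
  ¬ ¬ (∃[ M ] (rainbowCount t c ≤ M × IsMaxRainbow t n r M))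
¬¬IsMaxRainbow t {n} {r} c c-surjective ¬max =
  ¬¬-maximum Attained (suc (n C t)) (c , c-surjective , ℕₚ.≤-refl) unattainable
    λ (M , c≤M , (c′ , c′-surjective , M≤c′) , ¬attained) →
      let bounded : ∀ c″ → Surjective c″ → rainbowCount t c″ ≤ M
          bounded c″ c″-surjective = ℕₚ.≮⇒≥ λ M<c″ → ¬attained (c″ , c″-surjective , M<c″)
      in ¬max (M , c≤M , (c′ , c′-surjective , ℕₚ.≤-antisym (bounded c′ c′-surjective) M≤c′) , bounded)
  where
  Attained : ℕ → Set
  Attained x = ∃[ c′ ] (Surjective {n} {r} c′ × x ≤ rainbowCount t c′)
  unattainable : ¬ Attained (suc (n C t) + rainbowCount t c)
  unattainable (c′ , _ , big≤c′) = ℕₚ.<-irrefl refl (ℕₚ.<-≤-trans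
    (s≤s (ℕₚ.≤-trans (rainbowCount≤nCt c′ t) (ℕₚ.m≤m+n (n C t) _))) big≤c′)

scaled-density : ∀ t k s R M → R * s ^ t ≤ M → (t ! * R) * ((k * s) C t) ≤ M * k ^ t
scaled-density t k s R M Rsᵗ≤M = begin
  (t ! * R) * ((k * s) C t)   ≡⟨ cong (_* ((k * s) C t)) (ℕₚ.*-comm (t !) R) ⟩
  (R * t !) * ((k * s) C t)   ≡⟨ ℕₚ.*-assoc R (t !) _ ⟩
  R * (t ! * ((k * s) C t))   ≡⟨ cong (R *_) (k!*nCk≡fallingFactorial (k * s) t) ⟩
  R * fallingFactorial (k * s) t ≤⟨ ℕₚ.*-monoʳ-≤ R (fallingFactorial≤^ (k * s) t) ⟩
  R * (k * s) ^ t             ≡⟨ cong (R *_) (trans (^-distribʳ-* k s t) (ℕₚ.*-comm (k ^ t) (s ^ t))) ⟩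
  R * (s ^ t * k ^ t)         ≡⟨ ℕₚ.*-assoc R (s ^ t) (k ^ t) ⟨
  R * s ^ t * k ^ t           ≤⟨ ℕₚ.*-monoˡ-≤ (k ^ t) Rsᵗ≤M ⟩
  M * k ^ t                   ∎
  where open ℕₚ.≤-Reasoning

-- Cross-multiplied, t! R / kᵗ > randomRainbowProb t r; the balanced blow-ups of the colouring
-- have rainbow-Kₜ density at least t! R / kᵗ.
record DenserThanRandom (t r : ℕ) : Set where
  constructor denserThanRandom
  field
    k : ℕ
    colouring : EdgeColoring k r
    R : ℕ
    R≤rainbowCount : R ≤ rainbowCount t colouring
    beats-random : ((r C (t C 2)) * (t C 2) !) * k ^ t < (t ! * R) * r ^ (t C 2)

x<a*R*b⇒0<R : ∀ {x} a R b → x < (a * R) * b → 0 < R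
x<a*R*b⇒0<R {x} a zero b x<0 = ⊥-elim (ℕₚ.n≮0 (subst (x <_) (cong (_* b) (ℕₚ.*-zeroʳ a)) x<0))
x<a*R*b⇒0<R a (suc R) b _ = s≤s z≤n

denserThanRandom⇒uncommon : ∀ t r .{{_ : NonZero r}} → DenserThanRandom (2 + t) r → RainbowUncommon (2 + t) r
denserThanRandom⇒uncommon t r (denserThanRandom zero Φ R R≤0 beats-random) _ =
  ℕₚ.n≮0 (ℕₚ.<-≤-trans (x<a*R*b⇒0<R ((2 + t) !) R _ beats-random) R≤0)
denserThanRandom⇒uncommon t r (denserThanRandom (suc k′) Φ R R≤rainbowCount beats-random) common =
  ¬¬IsMaxRainbow t₂ c c-surjective λ (M , c≤M , isMax) →
    far-from L<D (D≤ratio M (ℕₚ.≤-trans Rsᵗ≤c c≤M)) (close n N≤n M isMax)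
  where
  t₂ = 2 + t
  e = t₂ C 2
  k = suc k′
  L = randomRainbowProb t₂ r
  D = ratio (t₂ ! * R) (k ^ t₂)
  L<D : L ℚ.< D
  L<D = ratio-< _ _ _ _ (ℕₚ.m^n>0 r e) (ℕₚ.m^n>0 k t₂) beats-random
  N = proj₁ (common (D ℚ.- L) (0<p-q L<D))
  close = proj₂ (common (D ℚ.- L) (0<p-q L<D))
  s = suc (N + r)
  n = k * s
  N≤n : N ≤ n
  N≤n = ℕₚ.≤-trans (ℕₚ.≤-trans (ℕₚ.m≤m+n N r) (ℕₚ.n≤1+n (N + r))) (ℕₚ.m≤n*m s k)
  ψ = starColouring s r
  c = BlowUp.blowUp Φ ψ
  c-surjective : Surjective c
  c-surjective = blowUp-surjective Φ (starColouring-surjective (s≤s (ℕₚ.m≤n+m r N)))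
  Rsᵗ≤c : R * s ^ t₂ ≤ rainbowCount t₂ c
  Rsᵗ≤c = ℕₚ.≤-trans (ℕₚ.*-monoˡ-≤ (s ^ t₂) R≤rainbowCount)
    (ℕₚ.≤-trans (ℕₚ.m≤m+n _ _) (BlowUp.rainbowCount-blowUp Φ ψ t))
  0<R : 0 < R
  0<R = x<a*R*b⇒0<R (t₂ !) R (r ^ e) beats-random
  D≤ratio : ∀ M → R * s ^ t₂ ≤ M → D ℚ.≤ ratio M (n C t₂)
  D≤ratio M Rsᵗ≤M = ratio-≤ _ _ _ _ (ℕₚ.m^n>0 k t₂) 0<nCt₂ (scaled-density t₂ k s R M Rsᵗ≤M)
    where
    0<nCt₂ : 0 < n C t₂
    0<nCt₂ = ℕₚ.≤-trans (ℕₚ.*-mono-≤ 0<R (ℕₚ.m^n>0 s t₂)) (ℕₚ.≤-trans Rsᵗ≤c (rainbowCount≤nCt c t₂))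

linearProduct : List ℕ → ℕ → ℕ
linearProduct [] x = 1
linearProduct (c ∷ cs) x = (c + x) * linearProduct cs x

linearProduct-++ : ∀ cs ds x → linearProduct (cs ++ ds) x ≡ linearProduct cs x * linearProduct ds x
linearProduct-++ [] ds x = sym (ℕₚ.+-identityʳ _)
linearProduct-++ (c ∷ cs) ds x = trans (cong ((c + x) *_) (linearProduct-++ cs ds x))
  (sym (ℕₚ.*-assoc (c + x) (linearProduct cs x) (linearProduct ds x)))

-- Polynomials with natural coefficients, constant term first.
eval : List ℕ → ℕ → ℕ
eval [] x = 0
eval (a ∷ p) x = a + x * eval p x

_⊕_ : List ℕ → List ℕ → List ℕ
[] ⊕ q = q
(a ∷ p) ⊕ [] = a ∷ p
(a ∷ p) ⊕ (b ∷ q) = a + b ∷ p ⊕ q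

eval-⊕ : ∀ p q x → eval (p ⊕ q) x ≡ eval p x + eval q x
eval-⊕ [] q x = refl
eval-⊕ (a ∷ p) [] x = sym (ℕₚ.+-identityʳ _)
eval-⊕ (a ∷ p) (b ∷ q) x = trans (cong (λ y → a + b + x * y) (eval-⊕ p q x))
  (solve 5 (λ a b x u v → a :+ b :+ x :* (u :+ v) := (a :+ x :* u) :+ (b :+ x :* v)) refl a b x (eval p x) (eval q x))

scale : ℕ → List ℕ → List ℕ
scale c [] = []
scale c (a ∷ p) = c * a ∷ scale c p

eval-scale : ∀ c p x → eval (scale c p) x ≡ c * eval p x
eval-scale c [] x = sym (ℕₚ.*-zeroʳ c)
eval-scale c (a ∷ p) x = trans (cong (λ y → c * a + x * y) (eval-scale c p x))
  (solve 4 (λ c a x u → c :* a :+ x :* (c :* u) := c :* (a :+ x :* u)) refl c a x (eval p x))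

coefficients : List ℕ → List ℕ
coefficients [] = 1 ∷ []
coefficients (c ∷ cs) = scale c (coefficients cs) ⊕ (0 ∷ coefficients cs)

eval-coefficients : ∀ cs x → eval (coefficients cs) x ≡ linearProduct cs x
eval-coefficients [] x = cong (1 +_) (ℕₚ.*-zeroʳ x)
eval-coefficients (c ∷ cs) x = begin
  eval (scale c p ⊕ (0 ∷ p)) x    ≡⟨ eval-⊕ (scale c p) (0 ∷ p) x ⟩
  eval (scale c p) x + x * eval p x ≡⟨ cong (_+ x * eval p x) (eval-scale c p x) ⟩
  c * eval p x + x * eval p x     ≡⟨ ℕₚ.*-distribʳ-+ (eval p x) c x ⟨
  (c + x) * eval p x              ≡⟨ cong ((c + x) *_) (eval-coefficients cs x) ⟩
  (c + x) * linearProduct cs x    ∎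
  where
  open ≡-Reasoning
  p = coefficients cs

_≤ᶜ_ : List ℕ → List ℕ → Bool
[] ≤ᶜ q = true
(a ∷ p) ≤ᶜ [] = false
(a ∷ p) ≤ᶜ (b ∷ q) = (a ≤ᵇ b) ∧ (p ≤ᶜ q)

_<ᶜ_ : List ℕ → List ℕ → Bool
[] <ᶜ q = false
(a ∷ p) <ᶜ [] = false
(a ∷ p) <ᶜ (b ∷ q) = (suc a ≤ᵇ b) ∧ (p ≤ᶜ q)

≤ᶜ-sound : ∀ p q x → T (p ≤ᶜ q) → eval p x ≤ eval q x
≤ᶜ-sound [] q x _ = z≤n
≤ᶜ-sound (a ∷ p) (b ∷ q) x a≤b∧p≤q with Equivalence.to T-∧ a≤b∧p≤q
... | a≤b , p≤q = ℕₚ.+-mono-≤ (ℕₚ.≤ᵇ⇒≤ a b a≤b) (ℕₚ.*-monoʳ-≤ x (≤ᶜ-sound p q x p≤q))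

<ᶜ-sound : ∀ p q x → T (p <ᶜ q) → eval p x < eval q x
<ᶜ-sound (a ∷ p) (b ∷ q) x a<b∧p≤q with Equivalence.to T-∧ a<b∧p≤q
... | a<b , p≤q = ℕₚ.+-mono-<-≤ (ℕₚ.≤ᵇ⇒≤ (suc a) b a<b) (ℕₚ.*-monoʳ-≤ x (≤ᶜ-sound p q x p≤q))

linearProduct-< : ∀ cs ds x → T (coefficients cs <ᶜ coefficients ds) → linearProduct cs x < linearProduct ds x
linearProduct-< cs ds x cs<ds = subst₂ _<_ (eval-coefficients cs x) (eval-coefficients ds x)
  (<ᶜ-sound (coefficients cs) (coefficients ds) x cs<ds)

-- Every triangle of the sum colouring is rainbow, which only matches the random density;
-- the triangles inside the parts of its blow-up provide the excess.
denserThanRandom-K₃ : ∀ m → DenserThanRandom 3 (3 + m)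
denserThanRandom-K₃ m = denserThanRandom (r * r) (BlowUp.blowUp σ σ) R R≤rainbowCount beats-random
  where
  r = 3 + m
  open SumColouring r using (σ; rainbowCount-triangles)
  X = r C 3
  R = X * r ^ 3 + r * X
  R≤rainbowCount : R ≤ rainbowCount 3 (BlowUp.blowUp σ σ)
  R≤rainbowCount = ℕₚ.≤-trans
    (ℕₚ.+-mono-≤ (ℕₚ.*-monoˡ-≤ (r ^ 3) rainbowCount-triangles) (ℕₚ.*-monoʳ-≤ r rainbowCount-triangles))
    (BlowUp.rainbowCount-blowUp σ σ 1)
  beats-random : (X * 6) * (r * r) ^ 3 < (6 * R) * r ^ 3
  beats-random = begin-strict
    (X * 6) * (r * r) ^ 3
      <⟨ ℕₚ.m<m+n _ (subst (0 <_) (cong (_* r ^ 4) (sym (nCk*k!≡fallingFactorial r 3))) (s≤s z≤n)) ⟩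
    (X * 6) * (r * r) ^ 3 + (X * 6) * r ^ 4
      ≡⟨ solve 2 (λ X r → (X :* con 6) :* ((r :* r) :* ((r :* r) :* ((r :* r) :* con 1)))
                           :+ (X :* con 6) :* (r :* (r :* (r :* (r :* con 1))))
                        := (con 6 :* (X :* (r :* (r :* (r :* con 1))) :+ r :* X)) :* (r :* (r :* (r :* con 1))))
                 refl X r ⟩
    (6 * R) * r ^ 3 ∎
    where open ℕₚ.≤-Reasoning

linearProduct-∷ʳ : ∀ cs c x → linearProduct cs x * (c + x) ≡ linearProduct (cs ++ c ∷ []) x
linearProduct-∷ʳ cs c x = trans (cong (linearProduct cs x *_) (sym (ℕₚ.*-identityʳ (c + x))))
  (sym (linearProduct-++ cs (c ∷ []) x))

4!*[rC4∸rC3] : ∀ r → 4 ! * (r C 4 ∸ r C 3) ≡ fallingFactorial r 3 * (r ∸ 3 ∸ 4)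
4!*[rC4∸rC3] r = begin
  4 ! * (r C 4 ∸ r C 3)                   ≡⟨ ℕₚ.*-distribˡ-∸ (4 !) (r C 4) (r C 3) ⟩
  4 ! * (r C 4) ∸ 4 ! * (r C 3)           ≡⟨ cong (4 ! * (r C 4) ∸_) (ℕₚ.*-assoc 4 (3 !) (r C 3)) ⟩
  4 ! * (r C 4) ∸ 4 * (3 ! * (r C 3))     ≡⟨ cong₂ _∸_ (trans (k!*nCk≡fallingFactorial r 4) (fallingFactorial-sucʳ r 3))
                                                        (cong (4 *_) (k!*nCk≡fallingFactorial r 3)) ⟩
  F * (r ∸ 3) ∸ 4 * F                     ≡⟨ cong (F * (r ∸ 3) ∸_) (ℕₚ.*-comm 4 F) ⟩
  F * (r ∸ 3) ∸ F * 4                     ≡⟨ ℕₚ.*-distribˡ-∸ F (r ∸ 3) 4 ⟨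
  F * (r ∸ 3 ∸ 4)                         ∎
  where
  open ≡-Reasoning
  F = fallingFactorial r 3

5!*[rC5∸rC3*[r∸4]] : ∀ r → 5 ! * (r C 5 ∸ (r C 3) * (r ∸ 4)) ≡ (fallingFactorial r 3 * (r ∸ 4)) * (r ∸ 3 ∸ 20)
5!*[rC5∸rC3*[r∸4]] r = begin
  5 ! * (r C 5 ∸ (r C 3) * (r ∸ 4))          ≡⟨ ℕₚ.*-distribˡ-∸ (5 !) (r C 5) ((r C 3) * (r ∸ 4)) ⟩
  5 ! * (r C 5) ∸ 5 ! * ((r C 3) * (r ∸ 4))  ≡⟨ cong₂ _∸_ five-five three-five ⟩
  (F * (r ∸ 4)) * (r ∸ 3) ∸ (F * (r ∸ 4)) * 20 ≡⟨ ℕₚ.*-distribˡ-∸ (F * (r ∸ 4)) (r ∸ 3) 20 ⟨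
  (F * (r ∸ 4)) * (r ∸ 3 ∸ 20)             ∎
  where
  open ≡-Reasoning
  F = fallingFactorial r 3
  five-five : 5 ! * (r C 5) ≡ (F * (r ∸ 4)) * (r ∸ 3)
  five-five = begin
    5 ! * (r C 5)                 ≡⟨ k!*nCk≡fallingFactorial r 5 ⟩
    fallingFactorial r 5          ≡⟨ fallingFactorial-sucʳ r 4 ⟩
    fallingFactorial r 4 * (r ∸ 4) ≡⟨ cong (_* (r ∸ 4)) (fallingFactorial-sucʳ r 3) ⟩
    (F * (r ∸ 3)) * (r ∸ 4)       ≡⟨ solve 3 (λ F a b → (F :* a) :* b := (F :* b) :* a) refl F (r ∸ 3) (r ∸ 4) ⟩
    (F * (r ∸ 4)) * (r ∸ 3)       ∎
  three-five : 5 ! * ((r C 3) * (r ∸ 4)) ≡ (F * (r ∸ 4)) * 20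
  three-five = begin
    5 ! * ((r C 3) * (r ∸ 4))       ≡⟨ solve 2 (λ X b → con 120 :* (X :* b) := (con 6 :* X) :* b :* con 20) refl (r C 3) (r ∸ 4) ⟩
    (3 ! * (r C 3)) * (r ∸ 4) * 20 ≡⟨ cong (λ x → x * (r ∸ 4) * 20) (k!*nCk≡fallingFactorial r 3) ⟩
    (F * (r ∸ 4)) * 20            ∎

denserThanRandom-K₄ : ∀ m → DenserThanRandom 4 (8 + m)
denserThanRandom-K₄ m = denserThanRandom r σ (r C 4 ∸ r C 3)
  (nonRainbowCount≤⇒rainbowCount≥ σ 4 nonRainbowCount-quadruples)
  (subst₂ _<_ lhs rhs (linearProduct-< (cs ++ r⁴) (ds ++ r⁴ ++ r²) m _))
  where
  r = 8 + m
  open SumColouring r using (σ; nonRainbowCount-quadruples)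
  cs = 8 ∷ 7 ∷ 6 ∷ 5 ∷ 4 ∷ 3 ∷ []
  ds = 8 ∷ 7 ∷ 6 ∷ 1 ∷ []
  r⁴ = 8 ∷ 8 ∷ 8 ∷ 8 ∷ []
  r² = 8 ∷ 8 ∷ []
  lhs : linearProduct (cs ++ r⁴) m ≡ ((r C 6) * 6 !) * r ^ 4
  lhs = trans (linearProduct-++ cs r⁴ m) (cong (_* r ^ 4) (sym (nCk*k!≡fallingFactorial r 6)))
  factor : linearProduct ds m ≡ 4 ! * (r C 4 ∸ r C 3)
  factor = trans (sym (linearProduct-∷ʳ (8 ∷ 7 ∷ 6 ∷ []) 1 m)) (sym (4!*[rC4∸rC3] r))
  rhs : linearProduct (ds ++ r⁴ ++ r²) m ≡ (4 ! * (r C 4 ∸ r C 3)) * r ^ 6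
  rhs = trans (linearProduct-++ ds (r⁴ ++ r²) m)
              (cong₂ _*_ factor (trans (linearProduct-++ r⁴ r² m) (sym (ℕₚ.^-distribˡ-+-* r 4 2))))

denserThanRandom-K₅ : ∀ m → DenserThanRandom 5 (31 + m)
denserThanRandom-K₅ m = denserThanRandom r σ (r C 5 ∸ (r C 3) * (r ∸ 4))
  (nonRainbowCount≤⇒rainbowCount≥ σ 5 (ℕₚ.≤-trans (nonRainbowCount-K₅ σ) (ℕₚ.*-monoˡ-≤ (r ∸ 4) nonRainbowCount-quadruples)))
  (subst₂ _<_ lhs rhs (linearProduct-< (cs ++ r⁵) (ds ++ r⁵ ++ r⁵) m _))
  where
  r = 31 + m
  open SumColouring r using (σ; nonRainbowCount-quadruples)
  cs = 31 ∷ 30 ∷ 29 ∷ 28 ∷ 27 ∷ 26 ∷ 25 ∷ 24 ∷ 23 ∷ 22 ∷ []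
  ds = 31 ∷ 30 ∷ 29 ∷ 27 ∷ 8 ∷ []
  r⁵ = 31 ∷ 31 ∷ 31 ∷ 31 ∷ 31 ∷ []
  lhs : linearProduct (cs ++ r⁵) m ≡ ((r C 10) * 10 !) * r ^ 5
  lhs = trans (linearProduct-++ cs r⁵ m) (cong (_* r ^ 5) (sym (nCk*k!≡fallingFactorial r 10)))
  factor : linearProduct ds m ≡ 5 ! * (r C 5 ∸ (r C 3) * (r ∸ 4))
  factor = trans (sym (linearProduct-∷ʳ (31 ∷ 30 ∷ 29 ∷ 27 ∷ []) 8 m))
           (trans (cong (_* (8 + m)) (sym (linearProduct-∷ʳ (31 ∷ 30 ∷ 29 ∷ []) 27 m)))
                  (sym (5!*[rC5∸rC3*[r∸4]] r)))
  rhs : linearProduct (ds ++ r⁵ ++ r⁵) m ≡ (5 ! * (r C 5 ∸ (r C 3) * (r ∸ 4))) * r ^ 10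
  rhs = trans (linearProduct-++ ds (r⁵ ++ r⁵) m)
              (cong₂ _*_ factor (trans (linearProduct-++ r⁵ r⁵ m) (sym (ℕₚ.^-distribˡ-+-* r 5 5))))

-- Numbers the edge a < b as b (b - 1) / 2 + a, so all edges of Kₖ get distinct colours
-- when k C 2 ≤ r.
distinctColouring : ∀ k r .{{_ : NonZero r}} → EdgeColoring k r
distinctColouring k r a b = ((toℕ b * (toℕ b ∸ 1)) / 2 + toℕ a) mod r

beatsRandomᵇ : ℕ → ℕ → ℕ → Bool
beatsRandomᵇ t zero k = false
beatsRandomᵇ t r@(suc _) k =
  suc (((r C (t C 2)) * (t C 2) !) * k ^ t) ≤ᵇ (t ! * rainbowCount t (distinctColouring k r)) * r ^ (t C 2)

beatsRandomᵇ⇒DenserThanRandom : ∀ t r k → T (beatsRandomᵇ t r k) → DenserThanRandom t r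
beatsRandomᵇ⇒DenserThanRandom t (suc r) k beats =
  denserThanRandom k (distinctColouring k (suc r)) _ ℕₚ.≤-refl (ℕₚ.≤ᵇ⇒≤ _ _ beats)

allBeatRandomᵇ : ℕ → ℕ → List ℕ → Bool
allBeatRandomᵇ t r [] = true
allBeatRandomᵇ t r (k ∷ ks) = beatsRandomᵇ t r k ∧ allBeatRandomᵇ t (suc r) ks

-- ks lists the clique sizes k used with distinctColouring for r, r + 1, ….
extendDownwards : ∀ t r ks → T (allBeatRandomᵇ t r ks) →
  (∀ m → DenserThanRandom t (length ks + r + m)) → ∀ m → DenserThanRandom t (r + m)
extendDownwards t r [] _ beyond m = beyond m
extendDownwards t r (k ∷ ks) checks beyond zero =
  subst (DenserThanRandom t) (sym (ℕₚ.+-identityʳ r)) (beatsRandomᵇ⇒DenserThanRandom t r k (proj₁ (Equivalence.to T-∧ checks)))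
extendDownwards t r (k ∷ ks) checks beyond (suc m) =
  subst (DenserThanRandom t) (sym (ℕₚ.+-suc r m)) (extendDownwards t (suc r) ks (proj₂ (Equivalence.to T-∧ checks))
    (λ m → subst (λ x → DenserThanRandom t (x + m)) (sym (ℕₚ.+-suc (length ks) r)) (beyond m)) m)

uncommon-from : ∀ t r₀ → (∀ m → DenserThanRandom (2 + t) (suc r₀ + m)) → ∀ r → suc r₀ ≤ r → RainbowUncommon (2 + t) r
uncommon-from t r₀ witnesses (suc r) (s≤s r₀≤r) = denserThanRandom⇒uncommon t (suc r)
  (subst (λ x → DenserThanRandom (2 + t) (suc x)) (ℕₚ.m+[n∸m]≡n r₀≤r) (witnesses (r ∸ r₀)))

theorem2 : (t : ℕ) → (t ≡ 3 ⊎ t ≡ 4 ⊎ t ≡ 5) →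
    (r : ℕ) → t C 2 ≤ r → RainbowUncommon t r
theorem2 t (inj₁ refl) = uncommon-from 1 2 denserThanRandom-K₃
theorem2 t (inj₂ (inj₁ refl)) = uncommon-from 2 5 (extendDownwards 4 6 (4 ∷ 4 ∷ []) _ denserThanRandom-K₄)
theorem2 t (inj₂ (inj₂ refl)) = uncommon-from 3 9
  (extendDownwards 5 10 (5 ∷ 5 ∷ 5 ∷ 5 ∷ 5 ∷ 5 ∷ 5 ∷ 5 ∷ 6 ∷ 6 ∷ 6 ∷ 6 ∷ 6 ∷ 7 ∷ 7 ∷ 7 ∷ 7 ∷ 7 ∷ 8 ∷ 8 ∷ 8 ∷ []) _ denserThanRandom-K₅)
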